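{- Let $P\colon\mathcal C^{op}\to\mathbf{InfSL}$ be an elementary existential doctrine. Then $\mathcal A_P$ is a cartesian bicategory. Moreover, the assignment $P\mapsto\mathcal A_P$ extends to a functor $\mathcal L\colon\mathbf{EED}\to\mathbf{CBC}$ which sends a morphism $(F,b)\colon P\to R$ in $\mathbf{EED}$, with $R\colon\mathcal D^{op}\to\mathbf{InfSL}$, to the functor $\mathcal L(F,b)\colon\mathcal A_P\to\mathcal A_R$ given on objects by $X\mapsto F(X)$ and on morphisms by $r\in P(X\times Y)\mapsto b_{X\times Y}(r)\in R(F(X)\times F(Y))$.
   Context: $\mathcal C$ is a cartesian category (chosen products $\times$, projections $\pi_i$, pairing, terminal $I$, diagonals $\Delta_A$, unique maps $!_A$). $\mathbf{InfSL}$: meet-semilattices with top and finite-meet-preserving maps; $P_f=P(f)$. An elementary existential doctrine is $P\colon\mathcal C^{op}\to\mathbf{InfSL}$ with elements $\delta_A\in P(A\times A)$ such that for $e=\mathrm{id}_X\times\Delta_A$, $P_e$ has left adjoint $\exists_e(\alpha)=P_{\langle\pi_1,\pi_2\rangle}(\alpha)\wedge P_{\langle\pi_2,\pi_3\rangle}(\delta_A)$, and for each product projection $\pi$, $P_\pi$ has a left adjoint $\exists_\pi$ satisfying Beck–Chevalley (for any projection $\pi\colon X\times A\to A$ and pullback $\pi f'=f\pi'$, $\exists_{\pi'}P_{f'}=P_f\exists_\pi$) and Frobenius reciprocity ($\exists_\pi(P_\pi(\alpha)\wedge\beta)=\alpha\wedge\exists_\pi(\beta)$). $\mathbf{EED}$: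 objects elementary existential doctrines; morphisms $P\to R$ are pairs $(F,b)$ with $F\colon\mathcal C\to\mathcal D$ a strict cartesian functor and $b\colon P\to R\circ F^{op}$ natural, with $b_{A\times A}(\delta^P_A)=\delta^R_{FA}$ and $b_A\circ\exists^P_\pi=\exists^R_{F\pi}\circ b_{X\times A}$ for projections $\pi\colon X\times A\to A$; composition $(G,c)\circ(F,b)=(GF,cF\circ b)$. $\mathcal A_P$: objects of $\mathcal C$; $\mathrm{Hom}(X,Y)=P(X\times Y)$ ordered as in $P$; identity $\delta_X$; composite of $f\in P(X\times Y)$, $g\in P(Y\times Z)$ is $\exists_{\langle\pi_1,\pi_3\rangle}(P_{\langle\pi_1,\pi_2\rangle}(f)\wedge P_{\langle\pi_2,\pi_3\rangle}(g))$ (projections out of $X\times Y\times Z$); tensor $\times$ on objects and $f\otimes g=P_{\langle\pi_1,\pi_3\rangle}(f)\wedge P_{\langle\pi_2,\pi_4\rangle}(g)\in P(A\times C\times B\times D)$ for $f\in P(A\times B)$, $g\in P(C\times D)$; graph functor $\Gamma_P(f)=P_{f\times\mathrm{id}_Y}(\delta_Y)$ for $f\colon X\to Y$; associator, unitors, symmetry are $\Gamma_P$ of those of $\mathcal C$; comonoid on $X$ is $d_X=\Gamma_P(\Delta_X)$, $e_X=\Gamma_P(!_X)$. A cartesian bicategory is a poset-enriched symmetric monoidal category $(\mathcal B,\otimes,I)$ where each $X$ has $d_X\colon X\to X\otimes X$, $e_X\colon X\to I$ such that (composition written $;$): (1) $(d_X,e_X)$ is a cocommutative comonoid; (2) $d_X,e_X$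 have right adjoints $d^*_X,e^*_X$ ($\mathrm{id}\le d;d^*$, $d^*;d\le\mathrm{id}$, likewise for $e$); (3) $(d_X\otimes\mathrm{id});(\mathrm{id}\otimes d_X^*)=d_X^*;d_X$; (4) $R;d_Y\le d_X;(R\otimes R)$ and $R;e_Y\le e_X$ for all $R\colon X\to Y$; (5) $e_{X\otimes Y}=e_X\otimes e_Y$, $d_{X\otimes Y}=(d_X\otimes d_Y);(\mathrm{id}\otimes\sigma\otimes\mathrm{id})$ up to coherence isomorphisms. $\mathbf{CBC}$: cartesian bicategories with strict monoidal functors preserving order and the chosen $d,e,d^*,e^*$. -}

module Defs where

open import Level using (Level; _⊔_; suc)
open import Relation.Binary.Core using (Rel)
open import Relation.Binary.Structures using (IsEquivalence; IsPartialOrder)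
open import Relation.Binary.Lattice.Bundles using (BoundedMeetSemilattice)
open import Relation.Binary.PropositionalEquality
  using (_≡_; refl; sym; trans; cong; subst; subst₂)
open import Relation.Binary.PropositionalEquality.Properties using (subst-subst)
open import Data.Product using (_×_; _,_)

record CartesianCategory (o h e : Level) : Set (suc (o ⊔ h ⊔ e)) where
  infixr 9 _∘_
  infix  4 _≈_
  infixr 7 _×₀_
  field
    Obj      : Set o
    _⇒_      : Obj → Obj → Set h
    _≈_      : ∀ {A B} → Rel (A ⇒ B) e
    ≈-equiv  : ∀ {A B} → IsEquivalence (_≈_ {A} {B})
    id       : ∀ {A} → A ⇒ A
    _∘_      : ∀ {A B C} → B ⇒ C → A ⇒ B → A ⇒ C
    ∘-resp-≈ : ∀ {A B C} {f f' : B ⇒ C} {g g' : A ⇒ B} →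
               f ≈ f' → g ≈ g' → f ∘ g ≈ f' ∘ g'
    identityˡ : ∀ {A B} {f : A ⇒ B} → id ∘ f ≈ f
    identityʳ : ∀ {A B} {f : A ⇒ B} → f ∘ id ≈ f
    assoc     : ∀ {A B C D} {f : A ⇒ B} {g : B ⇒ C} {k : C ⇒ D} →
                (k ∘ g) ∘ f ≈ k ∘ (g ∘ f)
    _×₀_     : Obj → Obj → Obj
    π₁       : ∀ {A B} → (A ×₀ B) ⇒ A
    π₂       : ∀ {A B} → (A ×₀ B) ⇒ B
    ⟨_,_⟩    : ∀ {C A B} → C ⇒ A → C ⇒ B → C ⇒ (A ×₀ B)
    project₁ : ∀ {C A B} {f : C ⇒ A} {g : C ⇒ B} → π₁ ∘ ⟨ f , g ⟩ ≈ f
    project₂ : ∀ {C A B} {f : C ⇒ A} {g : C ⇒ B} → π₂ ∘ ⟨ f , g ⟩ ≈ g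
    unique   : ∀ {C A B} {f : C ⇒ A} {g : C ⇒ B} {k : C ⇒ (A ×₀ B)} →
               π₁ ∘ k ≈ f → π₂ ∘ k ≈ g → ⟨ f , g ⟩ ≈ k
    𝟙        : Obj
    !        : ∀ {A} → A ⇒ 𝟙
    !-unique : ∀ {A} (f : A ⇒ 𝟙) → ! ≈ f

  Δ : ∀ {A} → A ⇒ (A ×₀ A)
  Δ = ⟨ id , id ⟩

  _⁂_ : ∀ {A B C D} → A ⇒ B → C ⇒ D → (A ×₀ C) ⇒ (B ×₀ D)
  f ⁂ g = ⟨ f ∘ π₁ , g ∘ π₂ ⟩

-- InfSL objects are bounded meet-semilattices (stdlib), the fibre P(A)
-- is  Fib A ; reindexing P_f is  reindex f.
-- Existential quantification is along the product projections
-- π₂ : X × A → A.  Triple products X × Y × Z are  X × (Y × Z).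

record EED {o h e} (C : CartesianCategory o h e) (c ℓ₁ ℓ₂ : Level)
       : Set (o ⊔ h ⊔ e ⊔ suc (c ⊔ ℓ₁ ⊔ ℓ₂)) where
  open CartesianCategory C
  field
    Fib : Obj → BoundedMeetSemilattice c ℓ₁ ℓ₂

  Pred : Obj → Set c
  Pred A = BoundedMeetSemilattice.Carrier (Fib A)

  infix 4 _≈ₚ_ _≤ₚ_
  infixr 7 _∧ₚ_
  _≈ₚ_ : ∀ {A} → Rel (Pred A) ℓ₁
  _≈ₚ_ {A} = BoundedMeetSemilattice._≈_ (Fib A)
  _≤ₚ_ : ∀ {A} → Rel (Pred A) ℓ₂
  _≤ₚ_ {A} = BoundedMeetSemilattice._≤_ (Fib A)
  _∧ₚ_ : ∀ {A} → Pred A → Pred A → Pred A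
  _∧ₚ_ {A} = BoundedMeetSemilattice._∧_ (Fib A)
  ⊤ₚ : ∀ {A} → Pred A
  ⊤ₚ {A} = BoundedMeetSemilattice.⊤ (Fib A)

  field
    reindex      : ∀ {A B} → A ⇒ B → Pred B → Pred A
    reindex-cong : ∀ {A B} (f : A ⇒ B) {α β : Pred B} →
                   α ≈ₚ β → reindex f α ≈ₚ reindex f β
    reindex-∧    : ∀ {A B} (f : A ⇒ B) (α β : Pred B) →
                   reindex f (α ∧ₚ β) ≈ₚ reindex f α ∧ₚ reindex f β
    reindex-⊤    : ∀ {A B} (f : A ⇒ B) → reindex f ⊤ₚ ≈ₚ ⊤ₚ
    reindex-resp : ∀ {A B} {f g : A ⇒ B} (α : Pred B) →
                   f ≈ g → reindex f α ≈ₚ reindex g α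
    reindex-id   : ∀ {A} (α : Pred A) → reindex id α ≈ₚ α
    reindex-∘    : ∀ {A B C} (f : A ⇒ B) (g : B ⇒ C) (α : Pred C) →
                   reindex (g ∘ f) α ≈ₚ reindex f (reindex g α)
    δ            : ∀ A → Pred (A ×₀ A)

  -- e = id_X × Δ_A : X × A → X × (A × A)  and the prescribed ∃_e
  ∃e : ∀ {X A} → Pred (X ×₀ A) → Pred (X ×₀ (A ×₀ A))
  ∃e {X} {A} α =
    reindex ⟨ π₁ , π₁ ∘ π₂ ⟩ α ∧ₚ reindex ⟨ π₁ ∘ π₂ , π₂ ∘ π₂ ⟩ (δ A)

  field
    ∃e-adj₁ : ∀ {X A} (α : Pred (X ×₀ A)) (β : Pred (X ×₀ (A ×₀ A))) →
              ∃e α ≤ₚ β → α ≤ₚ reindex (id {X} ⁂ Δ {A}) β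
    ∃e-adj₂ : ∀ {X A} (α : Pred (X ×₀ A)) (β : Pred (X ×₀ (A ×₀ A))) →
              α ≤ₚ reindex (id {X} ⁂ Δ {A}) β → ∃e α ≤ₚ β
    ∃π      : ∀ {X A} → Pred (X ×₀ A) → Pred A
    ∃π-adj₁ : ∀ {X A} (α : Pred (X ×₀ A)) (β : Pred A) →
              ∃π α ≤ₚ β → α ≤ₚ reindex (π₂ {X} {A}) β
    ∃π-adj₂ : ∀ {X A} (α : Pred (X ×₀ A)) (β : Pred A) →
              α ≤ₚ reindex (π₂ {X} {A}) β → ∃π α ≤ₚ β
    beck-chevalley : ∀ {X A B} (f : B ⇒ A) (α : Pred (X ×₀ A)) →
                     ∃π {X} {B} (reindex (id {X} ⁂ f) α) ≈ₚ reindex f (∃π α)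
    frobenius : ∀ {X A} (α : Pred A) (β : Pred (X ×₀ A)) →
                ∃π {X} {A} (reindex π₂ α ∧ₚ β) ≈ₚ α ∧ₚ ∃π β

record EEDObj (o h e c ℓ₁ ℓ₂ : Level) : Set (suc (o ⊔ h ⊔ e ⊔ c ⊔ ℓ₁ ⊔ ℓ₂)) where
  field
    Base : CartesianCategory o h e
    Doc  : EED Base c ℓ₁ ℓ₂

record StrictCartesianFunctor {o h e} (C D : CartesianCategory o h e)
       : Set (o ⊔ h ⊔ e) where
  private
    module C = CartesianCategory C
    module D = CartesianCategory D
  field
    F₀     : C.Obj → D.Obj
    F₁     : ∀ {A B} → A C.⇒ B → F₀ A D.⇒ F₀ B
    F-resp : ∀ {A B} {f g : A C.⇒ B} → f C.≈ g → F₁ f D.≈ F₁ g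
    F-id   : ∀ {A} → F₁ (C.id {A}) D.≈ D.id
    F-∘    : ∀ {A B C'} (f : A C.⇒ B) (g : B C.⇒ C') →
             F₁ (g C.∘ f) D.≈ F₁ g D.∘ F₁ f
    F-×    : ∀ A B → F₀ (A C.×₀ B) ≡ F₀ A D.×₀ F₀ B
    F-𝟙    : F₀ C.𝟙 ≡ D.𝟙
    F-π₁   : ∀ {A B} →
             subst (λ Z → Z D.⇒ F₀ A) (F-× A B) (F₁ (C.π₁ {A} {B})) D.≈ D.π₁
    F-π₂   : ∀ {A B} →
             subst (λ Z → Z D.⇒ F₀ B) (F-× A B) (F₁ (C.π₂ {A} {B})) D.≈ D.π₂

record EEDHom {o h e c ℓ₁ ℓ₂} (𝐏 𝐑 : EEDObj o h e c ℓ₁ ℓ₂)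
       : Set (o ⊔ h ⊔ e ⊔ c ⊔ ℓ₁ ⊔ ℓ₂) where
  private
    module C = CartesianCategory (EEDObj.Base 𝐏)
    module D = CartesianCategory (EEDObj.Base 𝐑)
    module P = EED (EEDObj.Doc 𝐏)
    module R = EED (EEDObj.Doc 𝐑)
  field
    F : StrictCartesianFunctor (EEDObj.Base 𝐏) (EEDObj.Base 𝐑)
  open StrictCartesianFunctor F
  field
    b     : ∀ A → P.Pred A → R.Pred (F₀ A)
    b-cong : ∀ A {α β : P.Pred A} → α P.≈ₚ β → b A α R.≈ₚ b A β
    b-∧    : ∀ A (α β : P.Pred A) → b A (α P.∧ₚ β) R.≈ₚ b A α R.∧ₚ b A β
    b-⊤    : ∀ A → b A P.⊤ₚ R.≈ₚ R.⊤ₚ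
    b-nat  : ∀ {A B} (f : A C.⇒ B) (α : P.Pred B) →
             b A (P.reindex f α) R.≈ₚ R.reindex (F₁ f) (b B α)
    b-δ    : ∀ A → subst R.Pred (F-× A A) (b (A C.×₀ A) (P.δ A)) R.≈ₚ R.δ (F₀ A)
    b-∃    : ∀ {X A} (α : P.Pred (X C.×₀ A)) →
             b A (P.∃π α) R.≈ₚ R.∃π {F₀ X} {F₀ A} (subst R.Pred (F-× X A) (b (X C.×₀ A) α))

module _ {o h e c ℓ₁ ℓ₂ : Level} where

  idEED : (𝐏 : EEDObj o h e c ℓ₁ ℓ₂) → EEDHom 𝐏 𝐏
  idEED 𝐏 = record
    { F = record
      { F₀ = λ A → A
      ; F₁ = λ f → f
      ; F-resp = λ p → p
      ; F-id = C≈refl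
      ; F-∘ = λ f g → C≈refl
      ; F-× = λ A B → refl
      ; F-𝟙 = refl
      ; F-π₁ = C≈refl
      ; F-π₂ = C≈refl
      }
    ; b = λ A α → α
    ; b-cong = λ A p → p
    ; b-∧ = λ A α β → P≈refl
    ; b-⊤ = λ A → P≈refl
    ; b-nat = λ f α → P≈refl
    ; b-δ = λ A → P≈refl
    ; b-∃ = λ α → P≈refl
    }
    where
      open EEDObj 𝐏
      open CartesianCategory Base
      open EED Doc
      C≈refl : ∀ {A B} {f : A ⇒ B} → f ≈ f
      C≈refl = IsEquivalence.refl ≈-equiv
      P≈refl : ∀ {A} {α : Pred A} → α ≈ₚ α
      P≈refl {A} = BoundedMeetSemilattice.Eq.refl (Fib A)

  infixr 9 _∘E_
  _∘E_ : {𝐏 𝐑 𝐒 : EEDObj o h e c ℓ₁ ℓ₂} → EEDHom 𝐑 𝐒 → EEDHom 𝐏 𝐑 → EEDHom 𝐏 𝐒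
  _∘E_ {𝐏} {𝐑} {𝐒} n m = record
    { F = record
      { F₀ = λ A → G₀ (F₀ A)
      ; F₁ = λ f → G₁ (F₁ f)
      ; F-resp = λ p → G-resp (F-resp p)
      ; F-id = E.trans' (G-resp F-id) G-id
      ; F-∘ = λ f g → E.trans' (G-resp (F-∘ f g)) (G-∘ (F₁ f) (F₁ g))
      ; F-× = F×'
      ; F-𝟙 = trans (cong G₀ F-𝟙) G-𝟙
      ; F-π₁ = λ {A} {B} →
          E.trans' (E.reflexive (sym (subst-subst (cong G₀ (F-× A B)))))
          (E.trans' (E.reflexive (cong (subst (λ W → W E.⇒ G₀ (F₀ A)) (G-× (F₀ A) (F₀ B)))
                                      (homG (F-× A B) (F₁ C.π₁))))
          (E.trans' (subst-≈E (G-× (F₀ A) (F₀ B)) (G-resp F-π₁)) G-π₁))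
      ; F-π₂ = λ {A} {B} →
          E.trans' (E.reflexive (sym (subst-subst (cong G₀ (F-× A B)))))
          (E.trans' (E.reflexive (cong (subst (λ W → W E.⇒ G₀ (F₀ B)) (G-× (F₀ A) (F₀ B)))
                                      (homG (F-× A B) (F₁ C.π₂))))
          (E.trans' (subst-≈E (G-× (F₀ A) (F₀ B)) (G-resp F-π₂)) G-π₂))
      }
    ; b = λ A α → n.b (F₀ A) (m.b A α)
    ; b-cong = λ A p → n.b-cong (F₀ A) (m.b-cong A p)
    ; b-∧ = λ A α β → S.Eq.trans (n.b-cong (F₀ A) (m.b-∧ A α β)) (n.b-∧ (F₀ A) _ _)
    ; b-⊤ = λ A → S.Eq.trans (n.b-cong (F₀ A) (m.b-⊤ A)) (n.b-⊤ (F₀ A))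
    ; b-nat = λ f α → S.Eq.trans (n.b-cong _ (m.b-nat f α)) (n.b-nat (F₁ f) (m.b _ α))
    ; b-δ = λ A →
        S.Eq.trans (S.Eq.reflexive (sym (subst-subst (cong G₀ (F-× A A)))))
        (S.Eq.trans (S.Eq.reflexive (cong (subst S.Pred (G-× (F₀ A) (F₀ A)))
                                          (predG (F-× A A) (m.b _ (P.δ A)))))
        (S.Eq.trans (subst-≈S (G-× (F₀ A) (F₀ A)) (n.b-cong _ (m.b-δ A)))
                    (n.b-δ (F₀ A))))
    ; b-∃ = λ {X} {A} α →
        S.Eq.trans (n.b-cong _ (m.b-∃ α))
        (S.Eq.trans (n.b-∃ (subst R.Pred (F-× X A) (m.b _ α)))
          (S.Eq.reflexive (cong S.∃π
            (trans (cong (subst S.Pred (G-× (F₀ X) (F₀ A)))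
                         (sym (predG (F-× X A) (m.b _ α))))
                   (subst-subst (cong G₀ (F-× X A)))))))
    }
    where
      module C = CartesianCategory (EEDObj.Base 𝐏)
      module D = CartesianCategory (EEDObj.Base 𝐑)
      module E' = CartesianCategory (EEDObj.Base 𝐒)
      module P = EED (EEDObj.Doc 𝐏)
      module R = EED (EEDObj.Doc 𝐑)
      module S' = EED (EEDObj.Doc 𝐒)
      module m = EEDHom m
      module n = EEDHom n
      open StrictCartesianFunctor m.F
      open StrictCartesianFunctor n.F renaming
        (F₀ to G₀; F₁ to G₁; F-resp to G-resp; F-id to G-id; F-∘ to G-∘;
         F-× to G-×; F-𝟙 to G-𝟙; F-π₁ to G-π₁; F-π₂ to G-π₂)
      module E where
        open E' public
        reflexive : ∀ {A B} {f g : A ⇒ B} → f ≡ g → f ≈ g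
        reflexive = IsEquivalence.reflexive ≈-equiv
        trans' : ∀ {A B} {f g k : A ⇒ B} → f ≈ g → g ≈ k → f ≈ k
        trans' = IsEquivalence.trans ≈-equiv
      module S where
        open S' public
        module Eq {A} = BoundedMeetSemilattice.Eq (Fib A)
      F×' : ∀ A B → G₀ (F₀ (A C.×₀ B)) ≡ G₀ (F₀ A) E.×₀ G₀ (F₀ B)
      F×' A B = trans (cong G₀ (F-× A B)) (G-× (F₀ A) (F₀ B))
      homG : ∀ {Z Z' V} (p : Z ≡ Z') (f : Z D.⇒ V) →
             subst (λ W → W E.⇒ G₀ V) (cong G₀ p) (G₁ f)
             ≡ G₁ (subst (λ W → W D.⇒ V) p f)
      homG refl f = refl
      subst-≈E : ∀ {Z Z' V} (q : Z ≡ Z') {f g : Z E.⇒ V} → f E.≈ g →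
                 subst (λ W → W E.⇒ V) q f E.≈ subst (λ W → W E.⇒ V) q g
      subst-≈E refl p = p
      predG : ∀ {Z Z'} (p : Z ≡ Z') (x : R.Pred Z) →
              subst S.Pred (cong G₀ p) (n.b Z x) ≡ n.b Z' (subst R.Pred p x)
      predG refl x = refl
      subst-≈S : ∀ {Z Z'} (q : Z ≡ Z') {x y : S.Pred Z} → x S.≈ₚ y →
                 subst S.Pred q x S.≈ₚ subst S.Pred q y
      subst-≈S refl p = p

-- Cartesian bicategories.
-- Data of a poset-enriched symmetric monoidal category with chosen
-- comonoid maps d, e.  Composition is written in diagrammatic order  f ⨾ g.

record CBData (o m ℓ₁ ℓ₂ : Level) : Set (suc (o ⊔ m ⊔ ℓ₁ ⊔ ℓ₂)) where
  infixr 9 _⨾_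
  infixr 10 _⊗₁_
  infixr 10 _⊗₀_
  infix 4 _≈_ _≤_
  field
    Obj  : Set o
    Hom  : Obj → Obj → Set m
    _≈_  : ∀ {A B} → Rel (Hom A B) ℓ₁
    _≤_  : ∀ {A B} → Rel (Hom A B) ℓ₂
    id   : ∀ {A} → Hom A A
    _⨾_  : ∀ {A B C} → Hom A B → Hom B C → Hom A C
    _⊗₀_ : Obj → Obj → Obj
    _⊗₁_ : ∀ {A B C D} → Hom A B → Hom C D → Hom (A ⊗₀ C) (B ⊗₀ D)
    𝕀    : Obj
    α    : ∀ {A B C} → Hom ((A ⊗₀ B) ⊗₀ C) (A ⊗₀ (B ⊗₀ C))
    α⁻¹  : ∀ {A B C} → Hom (A ⊗₀ (B ⊗₀ C)) ((A ⊗₀ B) ⊗₀ C)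
    lu   : ∀ {A} → Hom (𝕀 ⊗₀ A) A
    lu⁻¹ : ∀ {A} → Hom A (𝕀 ⊗₀ A)
    ru   : ∀ {A} → Hom (A ⊗₀ 𝕀) A
    ru⁻¹ : ∀ {A} → Hom A (A ⊗₀ 𝕀)
    σ    : ∀ {A B} → Hom (A ⊗₀ B) (B ⊗₀ A)
    d    : ∀ {A} → Hom A (A ⊗₀ A)
    e    : ∀ {A} → Hom A 𝕀

record IsCartesianBicategory {o m ℓ₁ ℓ₂} (B : CBData o m ℓ₁ ℓ₂)
       : Set (o ⊔ m ⊔ ℓ₁ ⊔ ℓ₂) where
  open CBData B
  field
    isPartialOrder : ∀ {A B} → IsPartialOrder (_≈_ {A} {B}) _≤_
    ⨾-mono   : ∀ {A B C} {f f' : Hom A B} {g g' : Hom B C} →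
               f ≤ f' → g ≤ g' → f ⨾ g ≤ f' ⨾ g'
    ⊗-mono   : ∀ {A B C D} {f f' : Hom A B} {g g' : Hom C D} →
               f ≤ f' → g ≤ g' → f ⊗₁ g ≤ f' ⊗₁ g'
    identityˡ : ∀ {A B} (f : Hom A B) → id ⨾ f ≈ f
    identityʳ : ∀ {A B} (f : Hom A B) → f ⨾ id ≈ f
    assoc     : ∀ {A B C D} (f : Hom A B) (g : Hom B C) (k : Hom C D) →
                (f ⨾ g) ⨾ k ≈ f ⨾ (g ⨾ k)
    ⊗-id      : ∀ {A C} → id {A} ⊗₁ id {C} ≈ id
    ⊗-⨾       : ∀ {A B C A' B' C'} (f : Hom A B) (g : Hom B C)
                  (f' : Hom A' B') (g' : Hom B' C') →
                (f ⨾ g) ⊗₁ (f' ⨾ g') ≈ (f ⊗₁ f') ⨾ (g ⊗₁ g')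
    α-iso₁   : ∀ {A B C} → α {A} {B} {C} ⨾ α⁻¹ ≈ id
    α-iso₂   : ∀ {A B C} → α⁻¹ ⨾ α {A} {B} {C} ≈ id
    lu-iso₁  : ∀ {A} → lu {A} ⨾ lu⁻¹ ≈ id
    lu-iso₂  : ∀ {A} → lu⁻¹ ⨾ lu {A} ≈ id
    ru-iso₁  : ∀ {A} → ru {A} ⨾ ru⁻¹ ≈ id
    ru-iso₂  : ∀ {A} → ru⁻¹ ⨾ ru {A} ≈ id
    σ-invol  : ∀ {A B} → σ {A} {B} ⨾ σ ≈ id
    α-nat    : ∀ {A B C A' B' C'} (f : Hom A A') (g : Hom B B') (k : Hom C C') →
               ((f ⊗₁ g) ⊗₁ k) ⨾ α ≈ α ⨾ (f ⊗₁ (g ⊗₁ k))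
    lu-nat   : ∀ {A B} (f : Hom A B) → (id {𝕀} ⊗₁ f) ⨾ lu ≈ lu ⨾ f
    ru-nat   : ∀ {A B} (f : Hom A B) → (f ⊗₁ id {𝕀}) ⨾ ru ≈ ru ⨾ f
    σ-nat    : ∀ {A B A' B'} (f : Hom A A') (g : Hom B B') →
               (f ⊗₁ g) ⨾ σ ≈ σ ⨾ (g ⊗₁ f)
    pentagon : ∀ {A B C D} →
               (α {A} {B} {C} ⊗₁ id {D}) ⨾ α ⨾ (id ⊗₁ α) ≈ α ⨾ α
    triangle : ∀ {A B} → α {A} {𝕀} {B} ⨾ (id ⊗₁ lu) ≈ ru ⊗₁ id
    hexagon  : ∀ {A B C} →
               α {A} {B} {C} ⨾ σ ⨾ α ≈ (σ ⊗₁ id) ⨾ α ⨾ (id ⊗₁ σ)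
    coassoc  : ∀ {A} → d {A} ⨾ (d ⊗₁ id) ⨾ α ≈ d ⨾ (id ⊗₁ d)
    counitˡ  : ∀ {A} → d {A} ⨾ (e ⊗₁ id) ⨾ lu ≈ id
    counitʳ  : ∀ {A} → d {A} ⨾ (id ⊗₁ e) ⨾ ru ≈ id
    cocomm   : ∀ {A} → d {A} ⨾ σ ≈ d
    d*       : ∀ {A} → Hom (A ⊗₀ A) A
    e*       : ∀ {A} → Hom 𝕀 A
    d-unit   : ∀ {A} → id ≤ d {A} ⨾ d*
    d-counit : ∀ {A} → d* ⨾ d {A} ≤ id
    e-unit   : ∀ {A} → id ≤ e {A} ⨾ e*
    e-counit : ∀ {A} → e* ⨾ e {A} ≤ id
    frob     : ∀ {A} → (d {A} ⊗₁ id) ⨾ α ⨾ (id ⊗₁ d*) ≈ d* ⨾ d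
    d-lax    : ∀ {A B} (R : Hom A B) → R ⨾ d ≤ d ⨾ (R ⊗₁ R)
    e-lax    : ∀ {A B} (R : Hom A B) → R ⨾ e ≤ e
    e-⊗      : ∀ {A B} → e {A ⊗₀ B} ≈ (e ⊗₁ e) ⨾ lu
    d-⊗      : ∀ {A B} →
               d {A ⊗₀ B} ≈ (d ⊗₁ d) ⨾ α ⨾ (id ⊗₁ (α⁻¹ ⨾ (σ ⊗₁ id) ⨾ α)) ⨾ α⁻¹

record CBFunctor {o m ℓ₁ ℓ₂} (B B' : CBData o m ℓ₁ ℓ₂) : Set (o ⊔ m) where
  private
    module B = CBData B
    module B' = CBData B'
  field
    F₀ : B.Obj → B'.Obj
    F₁ : ∀ {X Y} → B.Hom X Y → B'.Hom (F₀ X) (F₀ Y)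

record IsCBCMorphism {o m ℓ₁ ℓ₂} {B B' : CBData o m ℓ₁ ℓ₂}
       (cbB : IsCartesianBicategory B) (cbB' : IsCartesianBicategory B')
       (Φ : CBFunctor B B') : Set (o ⊔ m ⊔ ℓ₁ ⊔ ℓ₂) where
  private
    module B = CBData B
    module B' = CBData B'
    module cB = IsCartesianBicategory cbB
    module cB' = IsCartesianBicategory cbB'
    tr : ∀ {X X' Y Y'} → X ≡ X' → Y ≡ Y' → B'.Hom X Y → B'.Hom X' Y'
    tr p q f = subst₂ B'.Hom p q f
  open CBFunctor Φ
  field
    F-mono : ∀ {X Y} {f g : B.Hom X Y} → f B.≤ g → F₁ f B'.≤ F₁ g
    F-id   : ∀ {X} → F₁ (B.id {X}) B'.≈ B'.id
    F-⨾    : ∀ {X Y Z} (f : B.Hom X Y) (g : B.Hom Y Z) →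
             F₁ (f B.⨾ g) B'.≈ F₁ f B'.⨾ F₁ g
    F-⊗₀   : ∀ X Y → F₀ (X B.⊗₀ Y) ≡ F₀ X B'.⊗₀ F₀ Y
    F-𝕀    : F₀ B.𝕀 ≡ B'.𝕀
    F-⊗₁   : ∀ {X Y Z W} (f : B.Hom X Y) (g : B.Hom Z W) →
             tr (F-⊗₀ X Z) (F-⊗₀ Y W) (F₁ (f B.⊗₁ g)) B'.≈ F₁ f B'.⊗₁ F₁ g
    F-α    : ∀ {X Y Z} →
             tr (trans (F-⊗₀ (X B.⊗₀ Y) Z) (cong (B'._⊗₀ F₀ Z) (F-⊗₀ X Y)))
                (trans (F-⊗₀ X (Y B.⊗₀ Z)) (cong (F₀ X B'.⊗₀_) (F-⊗₀ Y Z)))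
                (F₁ (B.α {X} {Y} {Z})) B'.≈ B'.α
    F-α⁻¹  : ∀ {X Y Z} →
             tr (trans (F-⊗₀ X (Y B.⊗₀ Z)) (cong (F₀ X B'.⊗₀_) (F-⊗₀ Y Z)))
                (trans (F-⊗₀ (X B.⊗₀ Y) Z) (cong (B'._⊗₀ F₀ Z) (F-⊗₀ X Y)))
                (F₁ (B.α⁻¹ {X} {Y} {Z})) B'.≈ B'.α⁻¹
    F-lu   : ∀ {X} →
             tr (trans (F-⊗₀ B.𝕀 X) (cong (B'._⊗₀ F₀ X) F-𝕀)) refl
                (F₁ (B.lu {X})) B'.≈ B'.lu
    F-lu⁻¹ : ∀ {X} →
             tr refl (trans (F-⊗₀ B.𝕀 X) (cong (B'._⊗₀ F₀ X) F-𝕀))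
                (F₁ (B.lu⁻¹ {X})) B'.≈ B'.lu⁻¹
    F-ru   : ∀ {X} →
             tr (trans (F-⊗₀ X B.𝕀) (cong (F₀ X B'.⊗₀_) F-𝕀)) refl
                (F₁ (B.ru {X})) B'.≈ B'.ru
    F-ru⁻¹ : ∀ {X} →
             tr refl (trans (F-⊗₀ X B.𝕀) (cong (F₀ X B'.⊗₀_) F-𝕀))
                (F₁ (B.ru⁻¹ {X})) B'.≈ B'.ru⁻¹
    F-d    : ∀ {X} → tr refl (F-⊗₀ X X) (F₁ (B.d {X})) B'.≈ B'.d
    F-e    : ∀ {X} → tr refl F-𝕀 (F₁ (B.e {X})) B'.≈ B'.e
    F-d*   : ∀ {X} → tr (F-⊗₀ X X) refl (F₁ (cB.d* {X})) B'.≈ cB'.d*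
    F-e*   : ∀ {X} → tr F-𝕀 refl (F₁ (cB.e* {X})) B'.≈ cB'.e*

module _ {o h e c ℓ₁ ℓ₂ : Level} where

  𝒜 : EEDObj o h e c ℓ₁ ℓ₂ → CBData o c ℓ₁ ℓ₂
  𝒜 𝐏 = record
    { Obj  = Obj
    ; Hom  = λ X Y → Pred (X ×₀ Y)
    ; _≈_  = _≈ₚ_
    ; _≤_  = _≤ₚ_
    ; id   = λ {X} → δ X
    ; _⨾_  = comp
    ; _⊗₀_ = _×₀_
    ; _⊗₁_ = tensor
    ; 𝕀    = 𝟙
    ; α    = Γ ⟨ π₁ ∘ π₁ , ⟨ π₂ ∘ π₁ , π₂ ⟩ ⟩
    ; α⁻¹  = Γ ⟨ ⟨ π₁ , π₁ ∘ π₂ ⟩ , π₂ ∘ π₂ ⟩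
    ; lu   = Γ π₂
    ; lu⁻¹ = Γ ⟨ ! , id ⟩
    ; ru   = Γ π₁
    ; ru⁻¹ = Γ ⟨ id , ! ⟩
    ; σ    = Γ ⟨ π₂ , π₁ ⟩
    ; d    = Γ Δ
    ; e    = Γ !
    }
    where
      open EEDObj 𝐏
      open CartesianCategory Base
      open EED Doc
      Γ : ∀ {X Y} → X ⇒ Y → Pred (X ×₀ Y)
      Γ {X} {Y} f = reindex (f ⁂ id) (δ Y)
      -- ∃ along ⟨π₁,π₃⟩ : X × (Y × Z) → X × Z, i.e. along the product
      -- projection π₂ : Y × (X × Z) → X × Z precomposed with the canonical
      -- isomorphism φ : Y × (X × Z) ≅ X × (Y × Z)
      ∃₁₃ : ∀ {X Y Z} → Pred (X ×₀ (Y ×₀ Z)) → Pred (X ×₀ Z)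
      ∃₁₃ {X} {Y} {Z} γ = ∃π {Y} {X ×₀ Z} (reindex ⟨ π₁ ∘ π₂ , ⟨ π₁ , π₂ ∘ π₂ ⟩ ⟩ γ)
      comp : ∀ {X Y Z} → Pred (X ×₀ Y) → Pred (Y ×₀ Z) → Pred (X ×₀ Z)
      comp {X} {Y} {Z} f g =
        ∃₁₃ {X} {Y} {Z} (reindex ⟨ π₁ , π₁ ∘ π₂ ⟩ f ∧ₚ reindex ⟨ π₁ ∘ π₂ , π₂ ∘ π₂ ⟩ g)
      tensor : ∀ {A B C D} → Pred (A ×₀ B) → Pred (C ×₀ D) →
               Pred ((A ×₀ C) ×₀ (B ×₀ D))
      tensor f g = reindex ⟨ π₁ ∘ π₁ , π₁ ∘ π₂ ⟩ f ∧ₚ reindex ⟨ π₂ ∘ π₁ , π₂ ∘ π₂ ⟩ g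

  𝓛 : {𝐏 𝐑 : EEDObj o h e c ℓ₁ ℓ₂} → EEDHom 𝐏 𝐑 → CBFunctor (𝒜 𝐏) (𝒜 𝐑)
  𝓛 {𝐏} {𝐑} m = record
    { F₀ = F₀
    ; F₁ = λ {X} {Y} r → subst (EED.Pred (EEDObj.Doc 𝐑)) (F-× X Y) (b (X C.×₀ Y) r)
    }
    where
      module C = CartesianCategory (EEDObj.Base 𝐏)
      open EEDHom m
      open StrictCartesianFunctor F

{-# OPTIONS --safe #-}
-- A morphism X → Y of 𝒜 P is a predicate on X × Y, composition is relational
-- composition and every structure map is the graph of an arrow of C. Each axiom of a
-- cartesian bicategory is then an inequality between formulas of the regular fragment
-- of the internal logic of P, derivable from ∃-introduction and elimination,
-- Frobenius, Beck–Chevalley and reflexivity and substitution for δ. The coherence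
-- and comonoid equations need less: graphs compose and tensor like the underlying
-- arrows, so they reduce to equations in C. A morphism (F , b) of doctrines commutes with reindexing, ∧, ⊤, ∃
-- and δ, hence with the interpretation of every such formula, so 𝓛 (F , b) preserves
-- all the structure; functoriality of 𝓛 holds on the nose up to the transports along
-- F (X × Y) ≡ F X × F Y.
module Submission where

open import Defs
open import Level using (Level; _⊔_)
open import Relation.Binary.Structures using (IsEquivalence)
open import Relation.Binary.PropositionalEquality
  using (_≡_; refl; sym; trans; cong; cong₂; subst; subst₂)
open import Relation.Binary.PropositionalEquality.Properties using (trans-reflʳ)
open import Relation.Binary.Lattice.Bundles using (BoundedMeetSemilattice)
open import Data.Product using (Σ; _×_; _,_)
import Relation.Binary.Lattice.Properties.MeetSemilattice as MeetSemilatticeProperties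

-- Equations between arrows built from projections, pairing and ! are decided by
-- normalisation by evaluation into the free cartesian category over the arrows of C.
module CartesianTerms {o h e} (C : CartesianCategory o h e) where
  open CartesianCategory C

  module ≈ {A B} = IsEquivalence (≈-equiv {A} {B})

  ⟨⟩-cong : ∀ {X A B} {f f' : X ⇒ A} {g g' : X ⇒ B} → f ≈ f' → g ≈ g' → ⟨ f , g ⟩ ≈ ⟨ f' , g' ⟩
  ⟨⟩-cong p q = unique (≈.trans project₁ (≈.sym p)) (≈.trans project₂ (≈.sym q))

  ⟨⟩-∘ : ∀ {Y X A B} {f : X ⇒ A} {g : X ⇒ B} {k : Y ⇒ X} → ⟨ f , g ⟩ ∘ k ≈ ⟨ f ∘ k , g ∘ k ⟩
  ⟨⟩-∘ = ≈.sym (unique (≈.trans (≈.sym assoc) (∘-resp-≈ project₁ ≈.refl))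
                        (≈.trans (≈.sym assoc) (∘-resp-≈ project₂ ≈.refl)))

  ⟨⟩-η : ∀ {X A B} {k : X ⇒ (A ×₀ B)} → ⟨ π₁ ∘ k , π₂ ∘ k ⟩ ≈ k
  ⟨⟩-η = unique ≈.refl ≈.refl

  infixr 7 _×̂_
  data Ty : Set o where
    `_  : Obj → Ty
    _×̂_ : Ty → Ty → Ty
    𝟙̂   : Ty

  ⟦_⟧ : Ty → Obj
  ⟦ ` A ⟧ = A
  ⟦ A ×̂ B ⟧ = ⟦ A ⟧ ×₀ ⟦ B ⟧
  ⟦ 𝟙̂ ⟧ = 𝟙

  infixr 9 _∘ₜ_
  data Tm : Ty → Ty → Set (o ⊔ h) where
    idₜ    : ∀ {A} → Tm A A
    _∘ₜ_   : ∀ {A B C} → Tm B C → Tm A B → Tm A C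
    p₁     : ∀ {A B} → Tm (A ×̂ B) A
    p₂     : ∀ {A B} → Tm (A ×̂ B) B
    ⟨_,_⟩ₜ : ∀ {X A B} → Tm X A → Tm X B → Tm X (A ×̂ B)
    !ₜ     : ∀ {A} → Tm A 𝟙̂
    atom   : ∀ {A B} → ⟦ A ⟧ ⇒ ⟦ B ⟧ → Tm A B

  ⟦_⟧ₜ : ∀ {A B} → Tm A B → ⟦ A ⟧ ⇒ ⟦ B ⟧
  ⟦ idₜ ⟧ₜ = id
  ⟦ f ∘ₜ g ⟧ₜ = ⟦ f ⟧ₜ ∘ ⟦ g ⟧ₜ
  ⟦ p₁ ⟧ₜ = π₁
  ⟦ p₂ ⟧ₜ = π₂
  ⟦ ⟨ f , g ⟩ₜ ⟧ₜ = ⟨ ⟦ f ⟧ₜ , ⟦ g ⟧ₜ ⟩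
  ⟦ !ₜ ⟧ₜ = !
  ⟦ atom f ⟧ₜ = f

  Δₜ : ∀ {A} → Tm A (A ×̂ A)
  Δₜ = ⟨ idₜ , idₜ ⟩ₜ

  infixr 8 _⁂ₜ_
  _⁂ₜ_ : ∀ {A B C D} → Tm A B → Tm C D → Tm (A ×̂ C) (B ×̂ D)
  f ⁂ₜ g = ⟨ f ∘ₜ p₁ , g ∘ₜ p₂ ⟩ₜ

  mutual
    data Nf (Γ : Ty) : Ty → Set (o ⊔ h) where
      pairₙ : ∀ {A B} → Nf Γ A → Nf Γ B → Nf Γ (A ×̂ B)
      unitₙ : Nf Γ 𝟙̂
      neₙ   : ∀ {X} → Ne Γ (` X) → Nf Γ (` X)
    data Ne (Γ : Ty) : Ty → Set (o ⊔ h) where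
      var  : Ne Γ Γ
      fstₙ : ∀ {A B} → Ne Γ (A ×̂ B) → Ne Γ A
      sndₙ : ∀ {A B} → Ne Γ (A ×̂ B) → Ne Γ B
      app  : ∀ {A B} → ⟦ A ⟧ ⇒ ⟦ B ⟧ → Nf Γ A → Ne Γ B

  reflect : ∀ {Γ} A → Ne Γ A → Nf Γ A
  reflect (` X) n = neₙ n
  reflect (A ×̂ B) n = pairₙ (reflect A (fstₙ n)) (reflect B (sndₙ n))
  reflect 𝟙̂ n = unitₙ

  eval : ∀ {Γ A B} → Tm A B → Nf Γ A → Nf Γ B
  eval idₜ v = v
  eval (f ∘ₜ g) v = eval f (eval g v)
  eval p₁ (pairₙ a b) = a
  eval p₂ (pairₙ a b) = b
  eval ⟨ f , g ⟩ₜ v = pairₙ (eval f v) (eval g v)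
  eval !ₜ v = unitₙ
  eval (atom {B = B} f) v = reflect B (app f v)

  mutual
    ⟦_⟧N : ∀ {Γ A} → Nf Γ A → ⟦ Γ ⟧ ⇒ ⟦ A ⟧
    ⟦ pairₙ a b ⟧N = ⟨ ⟦ a ⟧N , ⟦ b ⟧N ⟩
    ⟦ unitₙ ⟧N = !
    ⟦ neₙ n ⟧N = ⟦ n ⟧Ne
    ⟦_⟧Ne : ∀ {Γ A} → Ne Γ A → ⟦ Γ ⟧ ⇒ ⟦ A ⟧
    ⟦ var ⟧Ne = id
    ⟦ fstₙ n ⟧Ne = π₁ ∘ ⟦ n ⟧Ne
    ⟦ sndₙ n ⟧Ne = π₂ ∘ ⟦ n ⟧Ne
    ⟦ app f v ⟧Ne = f ∘ ⟦ v ⟧N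

  reflect-sound : ∀ {Γ} A (n : Ne Γ A) → ⟦ reflect A n ⟧N ≈ ⟦ n ⟧Ne
  reflect-sound (` X) n = ≈.refl
  reflect-sound (A ×̂ B) n = ≈.trans (⟨⟩-cong (reflect-sound A (fstₙ n)) (reflect-sound B (sndₙ n))) ⟨⟩-η
  reflect-sound 𝟙̂ n = !-unique _

  eval-sound : ∀ {Γ A B} (t : Tm A B) (v : Nf Γ A) → ⟦ eval t v ⟧N ≈ ⟦ t ⟧ₜ ∘ ⟦ v ⟧N
  eval-sound idₜ v = ≈.sym identityˡ
  eval-sound (f ∘ₜ g) v = ≈.trans (eval-sound f (eval g v))
    (≈.trans (∘-resp-≈ ≈.refl (eval-sound g v)) (≈.sym assoc))
  eval-sound p₁ (pairₙ a b) = ≈.sym project₁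
  eval-sound p₂ (pairₙ a b) = ≈.sym project₂
  eval-sound ⟨ f , g ⟩ₜ v = ≈.trans (⟨⟩-cong (eval-sound f v) (eval-sound g v)) (≈.sym ⟨⟩-∘)
  eval-sound !ₜ v = !-unique _
  eval-sound (atom {B = B} f) v = reflect-sound B (app f v)

  nf : ∀ {Γ A} → Tm Γ A → Nf Γ A
  nf {Γ} t = eval t (reflect Γ var)

  nf-sound : ∀ {Γ A} (t : Tm Γ A) → ⟦ nf t ⟧N ≈ ⟦ t ⟧ₜ
  nf-sound {Γ} t = ≈.trans (eval-sound t (reflect Γ var))
    (≈.trans (∘-resp-≈ ≈.refl (reflect-sound Γ var)) identityʳ)

  solveₜ : ∀ {A B} (t u : Tm A B) → nf t ≡ nf u → ⟦ t ⟧ₜ ≈ ⟦ u ⟧ₜ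
  solveₜ t u p = ≈.trans (≈.sym (nf-sound t)) (≈.trans (≈.reflexive (cong ⟦_⟧N p)) (nf-sound u))

-- Inequalities in the fibres of P are proved in a small regular logic: formulas built
-- from atoms, ∧, ⊤, ∃ and substitution are normalised by pushing substitutions
-- to the atoms (Beck–Chevalley for ∃), so that two formulas with the same
-- normal form denote equal predicates.
module RegularLogic {o h e c ℓ₁ ℓ₂} (C : CartesianCategory o h e) (P : EED C c ℓ₁ ℓ₂) where
  open CartesianCategory C
  open EED P
  open CartesianTerms C public

  module L {A} = BoundedMeetSemilattice (Fib A)
  module MS {A} = MeetSemilatticeProperties (BoundedMeetSemilattice.meetSemilattice (Fib A))

  ≤-refl : ∀ {A} {x : Pred A} → x ≤ₚ x
  ≤-refl = L.refl
  ≤-trans : ∀ {A} {x y z : Pred A} → x ≤ₚ y → y ≤ₚ z → x ≤ₚ z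
  ≤-trans = L.trans
  ≈⇒≤ : ∀ {A} {x y : Pred A} → x ≈ₚ y → x ≤ₚ y
  ≈⇒≤ = L.reflexive
  ≈⇒≥ : ∀ {A} {x y : Pred A} → x ≈ₚ y → y ≤ₚ x
  ≈⇒≥ p = L.reflexive (L.Eq.sym p)
  antisym : ∀ {A} {x y : Pred A} → x ≤ₚ y → y ≤ₚ x → x ≈ₚ y
  antisym = L.antisym
  ∧-fst : ∀ {A} {x y : Pred A} → x ∧ₚ y ≤ₚ x
  ∧-fst = L.x∧y≤x _ _
  ∧-snd : ∀ {A} {x y : Pred A} → x ∧ₚ y ≤ₚ y
  ∧-snd = L.x∧y≤y _ _
  ∧-intro : ∀ {A} {x y z : Pred A} → x ≤ₚ y → x ≤ₚ z → x ≤ₚ y ∧ₚ z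
  ∧-intro = L.∧-greatest
  ⊤-max : ∀ {A} {x : Pred A} → x ≤ₚ ⊤ₚ
  ⊤-max = L.maximum _
  ∧-mono : ∀ {A} {x x' y y' : Pred A} → x ≤ₚ x' → y ≤ₚ y' → x ∧ₚ y ≤ₚ x' ∧ₚ y'
  ∧-mono = MS.∧-monotonic
  ∧-swap : ∀ {A} {x y : Pred A} → x ∧ₚ y ≤ₚ y ∧ₚ x
  ∧-swap = ∧-intro ∧-snd ∧-fst
  ∧-interchange : ∀ {A} {x y z w : Pred A} → (x ∧ₚ y) ∧ₚ (z ∧ₚ w) ≤ₚ (x ∧ₚ z) ∧ₚ (y ∧ₚ w)
  ∧-interchange = ∧-intro (∧-mono ∧-fst ∧-fst) (∧-mono ∧-snd ∧-snd)
  ⊤≤⇒≤ : ∀ {A} {x : Pred A} → ⊤ₚ ≤ₚ x → ∀ {y : Pred A} → y ≤ₚ x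
  ⊤≤⇒≤ p = ≤-trans ⊤-max p

  reindex-mono : ∀ {A B} (f : A ⇒ B) {α β : Pred B} → α ≤ₚ β → reindex f α ≤ₚ reindex f β
  reindex-mono f {α} {β} p =
    ≤-trans (≈⇒≤ (reindex-cong f (antisym (∧-intro ≤-refl p) ∧-fst)))
            (≤-trans (≈⇒≤ (reindex-∧ f α β)) ∧-snd)

  ∃-mono : ∀ {X A} {α β : Pred (X ×₀ A)} → α ≤ₚ β → ∃π α ≤ₚ ∃π β
  ∃-mono p = ∃π-adj₂ _ _ (≤-trans p (∃π-adj₁ _ _ ≤-refl))

  ∃-cong : ∀ {X A} {α β : Pred (X ×₀ A)} → α ≈ₚ β → ∃π α ≈ₚ ∃π β
  ∃-cong p = antisym (∃-mono (≈⇒≤ p)) (∃-mono (≈⇒≥ p))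

  infixr 7 _∧f_
  infixl 8 _[_]f
  data Fm : Ty → Set (o ⊔ h ⊔ c) where
    lift  : ∀ {Γ} → Pred ⟦ Γ ⟧ → Fm Γ
    _∧f_  : ∀ {Γ} → Fm Γ → Fm Γ → Fm Γ
    ⊤f    : ∀ {Γ} → Fm Γ
    ∃f    : ∀ {X Γ} → Fm (X ×̂ Γ) → Fm Γ
    _[_]f : ∀ {Γ Δ} → Fm Δ → Tm Γ Δ → Fm Γ

  ⟦_⟧F : ∀ {Γ} → Fm Γ → Pred ⟦ Γ ⟧
  ⟦ lift α ⟧F = α
  ⟦ φ ∧f ψ ⟧F = ⟦ φ ⟧F ∧ₚ ⟦ ψ ⟧F
  ⟦ ⊤f ⟧F = ⊤ₚ
  ⟦ ∃f φ ⟧F = ∃π ⟦ φ ⟧F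
  ⟦ φ [ t ]f ⟧F = reindex ⟦ t ⟧ₜ ⟦ φ ⟧F

  data NF : Ty → Set (o ⊔ h ⊔ c) where
    atomN : ∀ {Γ A} → Pred ⟦ A ⟧ → Nf Γ A → NF Γ
    _∧N_  : ∀ {Γ} → NF Γ → NF Γ → NF Γ
    ⊤N    : ∀ {Γ} → NF Γ
    ∃N    : ∀ {X Γ} → NF (X ×̂ Γ) → NF Γ

  ⟦_⟧NF : ∀ {Γ} → NF Γ → Pred ⟦ Γ ⟧
  ⟦ atomN α v ⟧NF = reindex ⟦ v ⟧N α
  ⟦ φ ∧N ψ ⟧NF = ⟦ φ ⟧NF ∧ₚ ⟦ ψ ⟧NF
  ⟦ ⊤N ⟧NF = ⊤ₚ
  ⟦ ∃N φ ⟧NF = ∃π ⟦ φ ⟧NF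

  norm : ∀ {Γ Δ} → Fm Δ → Tm Γ Δ → NF Γ
  norm (lift α) σ = atomN α (nf σ)
  norm (φ ∧f ψ) σ = norm φ σ ∧N norm ψ σ
  norm ⊤f σ = ⊤N
  norm (∃f φ) σ = ∃N (norm φ (idₜ ⁂ₜ σ))
  norm (φ [ τ ]f) σ = norm φ (τ ∘ₜ σ)

  norm-sound : ∀ {Γ Δ} (φ : Fm Δ) (σ : Tm Γ Δ) → ⟦ norm φ σ ⟧NF ≈ₚ reindex ⟦ σ ⟧ₜ ⟦ φ ⟧F
  norm-sound (lift α) σ = reindex-resp α (nf-sound σ)
  norm-sound (φ ∧f ψ) σ = L.Eq.trans (MS.∧-cong (norm-sound φ σ) (norm-sound ψ σ)) (L.Eq.sym (reindex-∧ _ _ _))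
  norm-sound ⊤f σ = L.Eq.sym (reindex-⊤ _)
  norm-sound (∃f φ) σ = L.Eq.trans (∃-cong (norm-sound φ (idₜ ⁂ₜ σ))) (beck-chevalley ⟦ σ ⟧ₜ ⟦ φ ⟧F)
  norm-sound (φ [ τ ]f) σ = L.Eq.trans (norm-sound φ (τ ∘ₜ σ)) (reindex-∘ ⟦ σ ⟧ₜ ⟦ τ ⟧ₜ ⟦ φ ⟧F)

  normF : ∀ {Γ} → Fm Γ → NF Γ
  normF φ = norm φ idₜ

  solveF : ∀ {Γ} (φ ψ : Fm Γ) → normF φ ≡ normF ψ → ⟦ φ ⟧F ≈ₚ ⟦ ψ ⟧F
  solveF φ ψ p = L.Eq.trans (L.Eq.sym (L.Eq.trans (norm-sound φ idₜ) (reindex-id _)))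
    (L.Eq.trans (L.Eq.reflexive (cong ⟦_⟧NF p)) (L.Eq.trans (norm-sound ψ idₜ) (reindex-id _)))

  solveF-≤ : ∀ {Γ} (φ ψ : Fm Γ) → normF φ ≡ normF ψ → ⟦ φ ⟧F ≤ₚ ⟦ ψ ⟧F
  solveF-≤ φ ψ p = ≈⇒≤ (solveF φ ψ p)

  solveF-via : ∀ {Γ} (φ ψ φ' ψ' : Fm Γ) → normF φ ≡ normF φ' → normF ψ ≡ normF ψ' →
               ⟦ φ' ⟧F ≈ₚ ⟦ ψ' ⟧F → ⟦ φ ⟧F ≈ₚ ⟦ ψ ⟧F
  solveF-via φ ψ φ' ψ' p q r = L.Eq.trans (solveF φ φ' p) (L.Eq.trans r (L.Eq.sym (solveF ψ ψ' q)))

  reindex-solve : ∀ {A B} (x : Pred ⟦ B ⟧) (t u : Tm A B) → nf t ≡ nf u →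
                  reindex ⟦ t ⟧ₜ x ≈ₚ reindex ⟦ u ⟧ₜ x
  reindex-solve x t u p = reindex-resp x (solveₜ t u p)

  -- Chains of inequalities whose steps are either proofs or agreement of normal
  -- forms (the latter written ≡⟦ refl ⟧ and checked by evaluation).
  record Chain {Γ} (φ χ : Fm Γ) : Set ℓ₂ where
    constructor mkC
    field prf : ⟦ φ ⟧F ≤ₚ ⟦ χ ⟧F
  open Chain public

  infixr 2 _≤⟦_⟧_ _≡⟦_⟧_
  infix 3 _∎F
  _≤⟦_⟧_ : ∀ {Γ} (φ : Fm Γ) {ψ χ : Fm Γ} → ⟦ φ ⟧F ≤ₚ ⟦ ψ ⟧F → Chain ψ χ → Chain φ χ
  φ ≤⟦ p ⟧ mkC q = mkC (≤-trans p q)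
  _≡⟦_⟧_ : ∀ {Γ} (φ : Fm Γ) {ψ χ : Fm Γ} → normF φ ≡ normF ψ → Chain ψ χ → Chain φ χ
  _≡⟦_⟧_ φ {ψ} p (mkC q) = mkC (≤-trans (solveF-≤ φ ψ p) q)
  _∎F : ∀ {Γ} (φ : Fm Γ) → Chain φ φ
  φ ∎F = mkC ≤-refl

  ∃-intro-at : ∀ {X Δ Γ} (φ : Fm (X ×̂ Δ)) (t : Tm Γ X) (σ : Tm Γ Δ) →
               ⟦ φ [ ⟨ t , σ ⟩ₜ ]f ⟧F ≤ₚ ⟦ ∃f φ [ σ ]f ⟧F
  ∃-intro-at {X} φ t σ = ≤-trans (reindex-mono _ (∃π-adj₁ _ _ ≤-refl))
    (≈⇒≤ (L.Eq.trans (L.Eq.sym (reindex-∘ _ _ _)) (reindex-solve _ (p₂ {X} ∘ₜ ⟨ t , σ ⟩ₜ) σ refl)))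

  ∃-intro : ∀ {X Γ} (φ : Fm (X ×̂ Γ)) (t : Tm Γ X) → ⟦ φ [ ⟨ t , idₜ ⟩ₜ ]f ⟧F ≤ₚ ⟦ ∃f φ ⟧F
  ∃-intro φ t = ≤-trans (∃-intro-at φ t idₜ) (≈⇒≤ (reindex-id _))

  ∃-elim : ∀ {X Γ} (φ : Fm (X ×̂ Γ)) (ψ : Fm Γ) → ⟦ φ ⟧F ≤ₚ ⟦ ψ [ p₂ {X} ]f ⟧F → ⟦ ∃f φ ⟧F ≤ₚ ⟦ ψ ⟧F
  ∃-elim φ ψ p = ∃π-adj₂ _ _ p

  ∃-elimʳ : ∀ {X Γ} (ψ : Fm Γ) (φ : Fm (X ×̂ Γ)) (χ : Fm Γ) →
            ⟦ ψ [ p₂ {X} ]f ∧f φ ⟧F ≤ₚ ⟦ χ [ p₂ {X} ]f ⟧F → ⟦ ψ ∧f ∃f φ ⟧F ≤ₚ ⟦ χ ⟧F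
  ∃-elimʳ ψ φ χ p = ≤-trans (≈⇒≥ (frobenius _ _)) (∃-elim (ψ [ p₂ ]f ∧f φ) χ p)

  ∃-elimˡ : ∀ {X Γ} (φ : Fm (X ×̂ Γ)) (ψ : Fm Γ) (χ : Fm Γ) →
            ⟦ φ ∧f ψ [ p₂ {X} ]f ⟧F ≤ₚ ⟦ χ [ p₂ {X} ]f ⟧F → ⟦ ∃f φ ∧f ψ ⟧F ≤ₚ ⟦ χ ⟧F
  ∃-elimˡ φ ψ χ p = ≤-trans ∧-swap (∃-elimʳ ψ φ χ (≤-trans ∧-swap p))

  EqF : ∀ {Γ A} → Tm Γ A → Tm Γ A → Fm Γ
  EqF {A = A} t u = lift {A ×̂ A} (δ ⟦ A ⟧) [ ⟨ t , u ⟩ₜ ]f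

  -- Reflexivity and the substitution rule are the unit and counit of ∃e ⊣ P_{id × Δ}.
  eq-refl : ∀ {Γ A} (t : Tm Γ A) → ⊤ₚ ≤ₚ ⟦ EqF t t ⟧F
  eq-refl {Γ} {A} t =
    ≤-trans (≈⇒≥ (reindex-⊤ ⟦ ⟨ !ₜ , t ⟩ₜ ⟧ₜ))
    (≤-trans (reindex-mono _ ⊤≤δ-on-diagonal)
      (solveF-≤ (lift {A ×̂ A} (δ ⟦ A ⟧) [ ⟨ p₁ ∘ₜ p₂ , p₂ ∘ₜ p₂ ⟩ₜ ]f [ idₜ ⁂ₜ Δₜ ]f [ ⟨ !ₜ , t ⟩ₜ ]f)
                (EqF t t) refl))
    where
      ⊤≤δ-on-diagonal : ⊤ₚ ≤ₚ reindex (id ⁂ Δ) (reindex ⟨ π₁ ∘ π₂ , π₂ ∘ π₂ ⟩ (δ ⟦ A ⟧))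
      ⊤≤δ-on-diagonal = ∃e-adj₁ {𝟙} {⟦ A ⟧} ⊤ₚ _ ∧-snd

  leibniz : ∀ {Γ X A} (ψ : Fm (X ×̂ A)) (s : Tm Γ X) (t u : Tm Γ A) →
            ⟦ EqF t u ∧f ψ [ ⟨ s , t ⟩ₜ ]f ⟧F ≤ₚ ⟦ ψ [ ⟨ s , u ⟩ₜ ]f ⟧F
  leibniz {Γ} {X} {A} ψ s t u =
    ≤-trans ∧-swap (≤-trans
      (solveF-≤ (φ [ ⟨ s , t ⟩ₜ ]f ∧f EqF t u) (∃e-body [ ⟨ s , ⟨ t , u ⟩ₜ ⟩ₜ ]f) refl)
      (≤-trans (reindex-mono _ ∃e≤φ)
      (solveF-≤ (φ [ ⟨ p₁ , p₂ ∘ₜ p₂ ⟩ₜ ]f [ ⟨ s , ⟨ t , u ⟩ₜ ⟩ₜ ]f) (φ [ ⟨ s , u ⟩ₜ ]f) refl)))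
    where
      φ : Fm (X ×̂ A)
      φ = lift ⟦ ψ ⟧F
      ∃e-body : Fm (X ×̂ (A ×̂ A))
      ∃e-body = φ [ ⟨ p₁ , p₁ ∘ₜ p₂ ⟩ₜ ]f ∧f lift {A ×̂ A} (δ ⟦ A ⟧) [ ⟨ p₁ ∘ₜ p₂ , p₂ ∘ₜ p₂ ⟩ₜ ]f
      ∃e≤φ : ∃e {⟦ X ⟧} {⟦ A ⟧} ⟦ φ ⟧F ≤ₚ ⟦ φ [ ⟨ p₁ , p₂ ∘ₜ p₂ {X} {A ×̂ A} ⟩ₜ ]f ⟧F
      ∃e≤φ = ∃e-adj₂ {⟦ X ⟧} {⟦ A ⟧} _ _
        (solveF-≤ φ (φ [ ⟨ p₁ , p₂ ∘ₜ p₂ {X} {A ×̂ A} ⟩ₜ ]f [ idₜ {X} ⁂ₜ Δₜ {A} ]f) refl)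

  eq-sym : ∀ {Γ A} (t u : Tm Γ A) → ⟦ EqF t u ⟧F ≤ₚ ⟦ EqF u t ⟧F
  eq-sym {Γ} {A} t u = prf (
    EqF t u ≤⟦ ∧-intro ≤-refl (⊤≤⇒≤ (eq-refl t)) ⟧
    EqF t u ∧f EqF t t ≡⟦ refl ⟧
    EqF t u ∧f ψ [ ⟨ t , t ⟩ₜ ]f ≤⟦ leibniz ψ t t u ⟧
    ψ [ ⟨ t , u ⟩ₜ ]f ≡⟦ refl ⟧
    EqF u t ∎F)
    where
      ψ : Fm (A ×̂ A)
      ψ = EqF (p₂ {A} {A}) p₁

  eq-trans : ∀ {Γ A} (t u v : Tm Γ A) → ⟦ EqF t u ∧f EqF u v ⟧F ≤ₚ ⟦ EqF t v ⟧F
  eq-trans {Γ} {A} t u v = prf (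
    EqF t u ∧f EqF u v ≤⟦ ∧-swap ⟧
    EqF u v ∧f EqF t u ≡⟦ refl ⟧
    EqF u v ∧f ψ [ ⟨ t , u ⟩ₜ ]f ≤⟦ leibniz ψ t u v ⟧
    ψ [ ⟨ t , v ⟩ₜ ]f ≡⟦ refl ⟧
    EqF t v ∎F)
    where
      ψ : Fm (A ×̂ A)
      ψ = EqF (p₁ {A} {A}) p₂

  eq-cong : ∀ {Γ A B} (f : Tm A B) (a b : Tm Γ A) → ⟦ EqF a b ⟧F ≤ₚ ⟦ EqF (f ∘ₜ a) (f ∘ₜ b) ⟧F
  eq-cong {Γ} {A} {B} f a b = prf (
    EqF a b ≤⟦ ∧-intro ≤-refl (⊤≤⇒≤ (eq-refl (f ∘ₜ a))) ⟧
    EqF a b ∧f EqF (f ∘ₜ a) (f ∘ₜ a) ≡⟦ refl ⟧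
    EqF a b ∧f ψ [ ⟨ a , a ⟩ₜ ]f ≤⟦ leibniz ψ a a b ⟧
    ψ [ ⟨ a , b ⟩ₜ ]f ≡⟦ refl ⟧
    EqF (f ∘ₜ a) (f ∘ₜ b) ∎F)
    where
      ψ : Fm (A ×̂ A)
      ψ = EqF (f ∘ₜ p₁ {A} {A}) (f ∘ₜ p₂)

  eq-𝟙 : ∀ {Γ} (t u : Tm Γ 𝟙̂) → ⊤ₚ ≤ₚ ⟦ EqF t u ⟧F
  eq-𝟙 t u = ≤-trans (≈⇒≥ (reindex-⊤ ⟦ ⟨ t , u ⟩ₜ ⟧ₜ)) (≤-trans (reindex-mono ⟦ ⟨ t , u ⟩ₜ ⟧ₜ eq-𝟙-generic)
    (solveF-≤ (EqF {𝟙̂ ×̂ 𝟙̂} {𝟙̂} p₁ p₂ [ ⟨ t , u ⟩ₜ ]f) (EqF t u) refl))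
    where
      eq-𝟙-generic : ⊤ₚ ≤ₚ ⟦ EqF {𝟙̂ ×̂ 𝟙̂} {𝟙̂} p₁ p₂ ⟧F
      eq-𝟙-generic = ≤-trans (eq-refl (p₁ {𝟙̂} {𝟙̂})) (solveF-≤ (EqF {𝟙̂ ×̂ 𝟙̂} {𝟙̂} p₁ p₁) (EqF p₁ p₂) refl)

  eq-×-split : ∀ {Γ A B} (t u : Tm Γ (A ×̂ B)) →
               ⟦ EqF t u ⟧F ≤ₚ ⟦ EqF (p₁ ∘ₜ t) (p₁ ∘ₜ u) ∧f EqF (p₂ ∘ₜ t) (p₂ ∘ₜ u) ⟧F
  eq-×-split t u = ∧-intro (eq-cong p₁ t u) (eq-cong p₂ t u)

  eq-×-join : ∀ {Γ A B} (t u : Tm Γ (A ×̂ B)) →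
              ⟦ EqF (p₁ ∘ₜ t) (p₁ ∘ₜ u) ∧f EqF (p₂ ∘ₜ t) (p₂ ∘ₜ u) ⟧F ≤ₚ ⟦ EqF t u ⟧F
  eq-×-join {Γ} {A} {B} t u = prf (
    EqF (p₁ ∘ₜ t) (p₁ ∘ₜ u) ∧f EqF (p₂ ∘ₜ t) (p₂ ∘ₜ u) ≡⟦ refl ⟧
    (EqF (p₁ ∘ₜ x) (p₁ ∘ₜ y) ∧f EqF (p₂ ∘ₜ x) (p₂ ∘ₜ y)) [ ⟨ t , u ⟩ₜ ]f
      ≤⟦ reindex-mono ⟦ ⟨ t , u ⟩ₜ ⟧ₜ generic ⟧
    EqF x y [ ⟨ t , u ⟩ₜ ]f ≡⟦ refl ⟧
    EqF t u ∎F)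
    where
      x y : Tm ((A ×̂ B) ×̂ (A ×̂ B)) (A ×̂ B)
      x = p₁
      y = p₂
      χ₁ : Fm ((A ×̂ B) ×̂ A)
      χ₁ = EqF (p₁ {A ×̂ B} {A}) ⟨ p₂ , p₂ ∘ₜ p₁ ⟩ₜ
      χ₂ : Fm (((A ×̂ B) ×̂ (A ×̂ B)) ×̂ B)
      χ₂ = EqF (p₁ ∘ₜ p₁) ⟨ p₁ ∘ₜ p₂ ∘ₜ p₁ , p₂ ⟩ₜ
      generic : ⟦ EqF (p₁ ∘ₜ x) (p₁ ∘ₜ y) ∧f EqF (p₂ ∘ₜ x) (p₂ ∘ₜ y) ⟧F ≤ₚ ⟦ EqF x y ⟧F
      generic = prf (
        EqF (p₁ ∘ₜ x) (p₁ ∘ₜ y) ∧f EqF (p₂ ∘ₜ x) (p₂ ∘ₜ y)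
          ≤⟦ ∧-intro ∧-snd (∧-intro ∧-fst (⊤≤⇒≤ (eq-refl x))) ⟧
        EqF (p₂ ∘ₜ x) (p₂ ∘ₜ y) ∧f (EqF (p₁ ∘ₜ x) (p₁ ∘ₜ y) ∧f EqF x x) ≡⟦ refl ⟧
        EqF (p₂ ∘ₜ x) (p₂ ∘ₜ y) ∧f (EqF (p₁ ∘ₜ x) (p₁ ∘ₜ y) ∧f χ₁ [ ⟨ x , p₁ ∘ₜ x ⟩ₜ ]f)
          ≤⟦ ∧-mono ≤-refl (leibniz χ₁ x (p₁ ∘ₜ x) (p₁ ∘ₜ y)) ⟧
        EqF (p₂ ∘ₜ x) (p₂ ∘ₜ y) ∧f χ₁ [ ⟨ x , p₁ ∘ₜ y ⟩ₜ ]f ≡⟦ refl ⟧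
        EqF (p₂ ∘ₜ x) (p₂ ∘ₜ y) ∧f χ₂ [ ⟨ idₜ , p₂ ∘ₜ x ⟩ₜ ]f
          ≤⟦ leibniz χ₂ idₜ (p₂ ∘ₜ x) (p₂ ∘ₜ y) ⟧
        χ₂ [ ⟨ idₜ , p₂ ∘ₜ y ⟩ₜ ]f ≡⟦ refl ⟧
        EqF x y ∎F)

module RelationsOf {o h ℓₑ c ℓ₁ ℓ₂} (𝐏 : EEDObj o h ℓₑ c ℓ₁ ℓ₂) where
  open EEDObj 𝐏
  open CartesianCategory Base using (∘-resp-≈) renaming (_≈_ to _≈ₜ_)
  open EED Doc using (Pred; δ; ⊤ₚ; _≈ₚ_; _≤ₚ_; reindex-resp)
  open RegularLogic Base Doc public
  open CBData (𝒜 𝐏)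

  compBody : ∀ {X Y Z} → Fm (X ×̂ Y) → Fm (Y ×̂ Z) → Fm (Y ×̂ (X ×̂ Z))
  compBody F G = (F [ ⟨ p₁ , p₁ ∘ₜ p₂ ⟩ₜ ]f ∧f G [ ⟨ p₁ ∘ₜ p₂ , p₂ ∘ₜ p₂ ⟩ₜ ]f)
                   [ ⟨ p₁ ∘ₜ p₂ , ⟨ p₁ , p₂ ∘ₜ p₂ ⟩ₜ ⟩ₜ ]f

  compF : ∀ {X Y Z} → Fm (X ×̂ Y) → Fm (Y ×̂ Z) → Fm (X ×̂ Z)
  compF F G = ∃f (compBody F G)

  tensF : ∀ {A B C D} → Fm (A ×̂ B) → Fm (C ×̂ D) → Fm ((A ×̂ C) ×̂ (B ×̂ D))
  tensF F G = F [ ⟨ p₁ ∘ₜ p₁ , p₁ ∘ₜ p₂ ⟩ₜ ]f ∧f G [ ⟨ p₂ ∘ₜ p₁ , p₂ ∘ₜ p₂ ⟩ₜ ]f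

  idF : ∀ {X} → Fm (X ×̂ X)
  idF {X} = lift {X ×̂ X} (δ ⟦ X ⟧)

  ΓF : ∀ {X Y} → Tm X Y → Fm (X ×̂ Y)
  ΓF {X} {Y} t = lift {Y ×̂ Y} (δ ⟦ Y ⟧) [ t ⁂ₜ idₜ ]f

  cographF : ∀ {Y Z} → Tm Z Y → Fm (Y ×̂ Z)
  cographF {Y} k = lift {Y ×̂ Y} (δ ⟦ Y ⟧) [ ⟨ p₁ , k ∘ₜ p₂ ⟩ₜ ]f

  comp-mono : ∀ {X Y Z} (F F' : Fm (X ×̂ Y)) (G G' : Fm (Y ×̂ Z)) → ⟦ F ⟧F ≤ₚ ⟦ F' ⟧F → ⟦ G ⟧F ≤ₚ ⟦ G' ⟧F →
              ⟦ compF F G ⟧F ≤ₚ ⟦ compF F' G' ⟧F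
  comp-mono F F' G G' p q = ∃-mono (reindex-mono _ (∧-mono (reindex-mono _ p) (reindex-mono _ q)))

  comp-cong : ∀ {X Y Z} (F F' : Fm (X ×̂ Y)) (G G' : Fm (Y ×̂ Z)) → ⟦ F ⟧F ≈ₚ ⟦ F' ⟧F → ⟦ G ⟧F ≈ₚ ⟦ G' ⟧F →
              ⟦ compF F G ⟧F ≈ₚ ⟦ compF F' G' ⟧F
  comp-cong F F' G G' p q = antisym (comp-mono F F' G G' (≈⇒≤ p) (≈⇒≤ q)) (comp-mono F' F G' G (≈⇒≥ p) (≈⇒≥ q))

  tens-mono : ∀ {A B C D} (F F' : Fm (A ×̂ B)) (G G' : Fm (C ×̂ D)) → ⟦ F ⟧F ≤ₚ ⟦ F' ⟧F → ⟦ G ⟧F ≤ₚ ⟦ G' ⟧F →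
              ⟦ tensF F G ⟧F ≤ₚ ⟦ tensF F' G' ⟧F
  tens-mono F F' G G' p q = ∧-mono (reindex-mono _ p) (reindex-mono _ q)

  tens-cong : ∀ {A B C D} (F F' : Fm (A ×̂ B)) (G G' : Fm (C ×̂ D)) → ⟦ F ⟧F ≈ₚ ⟦ F' ⟧F → ⟦ G ⟧F ≈ₚ ⟦ G' ⟧F →
              ⟦ tensF F G ⟧F ≈ₚ ⟦ tensF F' G' ⟧F
  tens-cong F F' G G' p q = antisym (tens-mono F F' G G' (≈⇒≤ p) (≈⇒≤ q)) (tens-mono F' F G' G (≈⇒≥ p) (≈⇒≥ q))

  graph-⨾ : ∀ {X Y Z} (t : Tm X Y) (S : Pred ⟦ Y ×̂ Z ⟧) →
            ⟦ compF (ΓF t) (lift {Y ×̂ Z} S) ⟧F ≈ₚ ⟦ lift {Y ×̂ Z} S [ t ⁂ₜ idₜ ]f ⟧F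
  graph-⨾ {X} {Y} {Z} t S = antisym
    (∃-elim (compBody (ΓF t) Sf) (Sf [ t ⁂ₜ idₜ ]f) (prf (
      compBody (ΓF t) Sf ≡⟦ refl ⟧
      EqF (t ∘ₜ x) y ∧f S' [ ⟨ z , y ⟩ₜ ]f ≤⟦ ∧-mono (eq-sym (t ∘ₜ x) y) ≤-refl ⟧
      EqF y (t ∘ₜ x) ∧f S' [ ⟨ z , y ⟩ₜ ]f ≤⟦ leibniz S' z y (t ∘ₜ x) ⟧
      S' [ ⟨ z , t ∘ₜ x ⟩ₜ ]f ≡⟦ refl ⟧
      Sf [ t ⁂ₜ idₜ ]f [ p₂ ]f ∎F)))
    (prf (
      Sf [ t ⁂ₜ idₜ ]f ≤⟦ ∧-intro ⊤-max ≤-refl ⟧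
      ⊤f ∧f Sf [ t ⁂ₜ idₜ ]f ≤⟦ ∧-mono (eq-refl (t ∘ₜ p₁ {X} {Z})) ≤-refl ⟧
      EqF (t ∘ₜ p₁) (t ∘ₜ p₁) ∧f Sf [ t ⁂ₜ idₜ ]f ≡⟦ refl ⟧
      compBody (ΓF t) Sf [ ⟨ t ∘ₜ p₁ , idₜ ⟩ₜ ]f ≤⟦ ∃-intro (compBody (ΓF t) Sf) (t ∘ₜ p₁) ⟧
      compF (ΓF t) Sf ∎F))
    where
      Sf : Fm (Y ×̂ Z)
      Sf = lift S
      S' : Fm (Z ×̂ Y)
      S' = Sf [ ⟨ p₂ , p₁ ⟩ₜ ]f
      y : Tm (Y ×̂ (X ×̂ Z)) Y
      y = p₁
      x : Tm (Y ×̂ (X ×̂ Z)) X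
      x = p₁ ∘ₜ p₂
      z : Tm (Y ×̂ (X ×̂ Z)) Z
      z = p₂ ∘ₜ p₂

  ⨾-cograph : ∀ {X Y Z} (R : Pred ⟦ X ×̂ Y ⟧) (k : Tm Z Y) →
              ⟦ compF (lift {X ×̂ Y} R) (cographF k) ⟧F ≈ₚ ⟦ lift {X ×̂ Y} R [ idₜ ⁂ₜ k ]f ⟧F
  ⨾-cograph {X} {Y} {Z} R k = antisym
    (∃-elim (compBody Rf (cographF k)) (Rf [ idₜ ⁂ₜ k ]f) (prf (
      compBody Rf (cographF k) ≡⟦ refl ⟧
      Rf [ ⟨ x , y ⟩ₜ ]f ∧f EqF y (k ∘ₜ z) ≤⟦ ∧-swap ⟧
      EqF y (k ∘ₜ z) ∧f Rf [ ⟨ x , y ⟩ₜ ]f ≤⟦ leibniz Rf x y (k ∘ₜ z) ⟧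
      Rf [ ⟨ x , k ∘ₜ z ⟩ₜ ]f ≡⟦ refl ⟧
      Rf [ idₜ ⁂ₜ k ]f [ p₂ ]f ∎F)))
    (prf (
      Rf [ idₜ ⁂ₜ k ]f ≤⟦ ∧-intro ≤-refl ⊤-max ⟧
      Rf [ idₜ ⁂ₜ k ]f ∧f ⊤f ≤⟦ ∧-mono ≤-refl (eq-refl (k ∘ₜ p₂ {X} {Z})) ⟧
      Rf [ idₜ ⁂ₜ k ]f ∧f EqF (k ∘ₜ p₂) (k ∘ₜ p₂) ≡⟦ refl ⟧
      compBody Rf (cographF k) [ ⟨ k ∘ₜ p₂ , idₜ ⟩ₜ ]f ≤⟦ ∃-intro (compBody Rf (cographF k)) (k ∘ₜ p₂) ⟧
      compF Rf (cographF k) ∎F))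
    where
      Rf : Fm (X ×̂ Y)
      Rf = lift R
      y : Tm (Y ×̂ (X ×̂ Z)) Y
      y = p₁
      x : Tm (Y ×̂ (X ×̂ Z)) X
      x = p₁ ∘ₜ p₂
      z : Tm (Y ×̂ (X ×̂ Z)) Z
      z = p₂ ∘ₜ p₂

  -- The hypotheses say that k is inverse to t; they are closed by refl for concrete isomorphisms.
  graph≈cograph-inverse : ∀ {Y Z} (t : Tm Y Z) (k : Tm Z Y) →
    normF (EqF (k ∘ₜ t ∘ₜ p₁ {Y} {Z}) (k ∘ₜ p₂)) ≡ normF (cographF k) →
    normF (EqF (t ∘ₜ p₁ {Y} {Z}) (t ∘ₜ k ∘ₜ p₂)) ≡ normF (ΓF t) →
    ⟦ ΓF t ⟧F ≈ₚ ⟦ cographF k ⟧F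
  graph≈cograph-inverse t k kt≈id tk≈id = antisym
    (prf (ΓF t ≡⟦ refl ⟧ EqF (t ∘ₜ p₁) p₂ ≤⟦ eq-cong k (t ∘ₜ p₁) p₂ ⟧
          EqF (k ∘ₜ t ∘ₜ p₁) (k ∘ₜ p₂) ≡⟦ kt≈id ⟧ cographF k ∎F))
    (prf (cographF k ≡⟦ refl ⟧ EqF p₁ (k ∘ₜ p₂) ≤⟦ eq-cong t p₁ (k ∘ₜ p₂) ⟧
          EqF (t ∘ₜ p₁) (t ∘ₜ k ∘ₜ p₂) ≡⟦ tk≈id ⟧ ΓF t ∎F))

  ⨾-graph-iso : ∀ {X Y Z} (R : Pred ⟦ X ×̂ Y ⟧) (t : Tm Y Z) (k : Tm Z Y) →
    normF (EqF (k ∘ₜ t ∘ₜ p₁ {Y} {Z}) (k ∘ₜ p₂)) ≡ normF (cographF k) →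
    normF (EqF (t ∘ₜ p₁ {Y} {Z}) (t ∘ₜ k ∘ₜ p₂)) ≡ normF (ΓF t) →
    ⟦ compF (lift {X ×̂ Y} R) (ΓF t) ⟧F ≈ₚ ⟦ lift {X ×̂ Y} R [ idₜ ⁂ₜ k ]f ⟧F
  ⨾-graph-iso {X} R t k kt≈id tk≈id = L.Eq.trans
    (comp-cong (lift {X ×̂ _} R) (lift R) (ΓF t) (cographF k) L.Eq.refl (graph≈cograph-inverse t k kt≈id tk≈id))
    (⨾-cograph {X} R k)

  graph-∘ : ∀ {X Y Z} (t : Tm X Y) (u : Tm Y Z) → ⟦ compF (ΓF t) (ΓF u) ⟧F ≈ₚ ⟦ ΓF (u ∘ₜ t) ⟧F
  graph-∘ {X} {Y} {Z} t u = L.Eq.trans (graph-⨾ {X} {Y} {Z} t ⟦ ΓF u ⟧F) (solveF (ΓF u [ t ⁂ₜ idₜ ]f) (ΓF (u ∘ₜ t)) refl)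

  graph-⁂ : ∀ {A B C D} (t : Tm A B) (u : Tm C D) → ⟦ tensF (ΓF t) (ΓF u) ⟧F ≈ₚ ⟦ ΓF (t ⁂ₜ u) ⟧F
  graph-⁂ {A} {B} {C} {D} t u = antisym
    (prf (tensF (ΓF t) (ΓF u) ≡⟦ refl ⟧
          EqF (p₁ ∘ₜ v) (p₁ ∘ₜ w) ∧f EqF (p₂ ∘ₜ v) (p₂ ∘ₜ w) ≤⟦ eq-×-join v w ⟧
          EqF v w ≡⟦ refl ⟧ ΓF (t ⁂ₜ u) ∎F))
    (prf (ΓF (t ⁂ₜ u) ≡⟦ refl ⟧ EqF v w ≤⟦ eq-×-split v w ⟧
          EqF (p₁ ∘ₜ v) (p₁ ∘ₜ w) ∧f EqF (p₂ ∘ₜ v) (p₂ ∘ₜ w) ≡⟦ refl ⟧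
          tensF (ΓF t) (ΓF u) ∎F))
    where
      v w : Tm ((A ×̂ C) ×̂ (B ×̂ D)) (B ×̂ D)
      v = (t ⁂ₜ u) ∘ₜ p₁
      w = p₂

  graph-resp : ∀ {X Y} (t u : Tm X Y) → ⟦ t ⟧ₜ ≈ₜ ⟦ u ⟧ₜ → ⟦ ΓF t ⟧F ≈ₚ ⟦ ΓF u ⟧F
  graph-resp t u p = reindex-resp _ (⟨⟩-cong (∘-resp-≈ p ≈.refl) ≈.refl)

  infixr 9 _⨾G_
  infixr 10 _⊗G_
  data GraphExpr : Ty → Ty → Set (o ⊔ h) where
    gr   : ∀ {A B} → Tm A B → GraphExpr A B
    idG  : ∀ {A} → GraphExpr A A
    _⨾G_ : ∀ {A B C} → GraphExpr A B → GraphExpr B C → GraphExpr A C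
    _⊗G_ : ∀ {A B C D} → GraphExpr A B → GraphExpr C D → GraphExpr (A ×̂ C) (B ×̂ D)

  ⟦_⟧G : ∀ {A B} → GraphExpr A B → Fm (A ×̂ B)
  ⟦ gr t ⟧G = ΓF t
  ⟦ idG ⟧G = idF
  ⟦ g ⨾G g' ⟧G = compF ⟦ g ⟧G ⟦ g' ⟧G
  ⟦ g ⊗G g' ⟧G = tensF ⟦ g ⟧G ⟦ g' ⟧G

  underlyingTm : ∀ {A B} → GraphExpr A B → Tm A B
  underlyingTm (gr t) = t
  underlyingTm idG = idₜ
  underlyingTm (g ⨾G g') = underlyingTm g' ∘ₜ underlyingTm g
  underlyingTm (g ⊗G g') = underlyingTm g ⁂ₜ underlyingTm g'

  GraphExpr≈graph : ∀ {A B} (g : GraphExpr A B) → ⟦ ⟦ g ⟧G ⟧F ≈ₚ ⟦ ΓF (underlyingTm g) ⟧F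
  GraphExpr≈graph (gr t) = L.Eq.refl
  GraphExpr≈graph {A} idG = solveF (idF {A}) (ΓF idₜ) refl
  GraphExpr≈graph (g ⨾G g') = L.Eq.trans
    (comp-cong ⟦ g ⟧G (ΓF (underlyingTm g)) ⟦ g' ⟧G (ΓF (underlyingTm g')) (GraphExpr≈graph g) (GraphExpr≈graph g'))
    (graph-∘ (underlyingTm g) (underlyingTm g'))
  GraphExpr≈graph (g ⊗G g') = L.Eq.trans
    (tens-cong ⟦ g ⟧G (ΓF (underlyingTm g)) ⟦ g' ⟧G (ΓF (underlyingTm g')) (GraphExpr≈graph g) (GraphExpr≈graph g'))
    (graph-⁂ (underlyingTm g) (underlyingTm g'))

  solveG : ∀ {A B} (g g' : GraphExpr A B) → nf (underlyingTm g) ≡ nf (underlyingTm g') → ⟦ ⟦ g ⟧G ⟧F ≈ₚ ⟦ ⟦ g' ⟧G ⟧F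
  solveG g g' p = L.Eq.trans (GraphExpr≈graph g)
    (L.Eq.trans (graph-resp (underlyingTm g) (underlyingTm g') (solveₜ (underlyingTm g) (underlyingTm g') p))
                (L.Eq.sym (GraphExpr≈graph g')))

  αₜ : ∀ A B C → Tm ((A ×̂ B) ×̂ C) (A ×̂ (B ×̂ C))
  αₜ A B C = ⟨ p₁ ∘ₜ p₁ , ⟨ p₂ ∘ₜ p₁ , p₂ ⟩ₜ ⟩ₜ
  α⁻¹ₜ : ∀ A B C → Tm (A ×̂ (B ×̂ C)) ((A ×̂ B) ×̂ C)
  α⁻¹ₜ A B C = ⟨ ⟨ p₁ , p₁ ∘ₜ p₂ ⟩ₜ , p₂ ∘ₜ p₂ ⟩ₜ
  luₜ : ∀ A → Tm (𝟙̂ ×̂ A) A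
  luₜ A = p₂
  lu⁻¹ₜ : ∀ A → Tm A (𝟙̂ ×̂ A)
  lu⁻¹ₜ A = ⟨ !ₜ , idₜ ⟩ₜ
  ruₜ : ∀ A → Tm (A ×̂ 𝟙̂) A
  ruₜ A = p₁
  ru⁻¹ₜ : ∀ A → Tm A (A ×̂ 𝟙̂)
  ru⁻¹ₜ A = ⟨ idₜ , !ₜ ⟩ₜ
  σₜ : ∀ A B → Tm (A ×̂ B) (B ×̂ A)
  σₜ A B = ⟨ p₂ , p₁ ⟩ₜ

  αG : ∀ A B C → GraphExpr ((A ×̂ B) ×̂ C) (A ×̂ (B ×̂ C))
  αG A B C = gr (αₜ A B C)
  α⁻¹G : ∀ A B C → GraphExpr (A ×̂ (B ×̂ C)) ((A ×̂ B) ×̂ C)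
  α⁻¹G A B C = gr (α⁻¹ₜ A B C)
  luG : ∀ A → GraphExpr (𝟙̂ ×̂ A) A
  luG A = gr (luₜ A)
  lu⁻¹G : ∀ A → GraphExpr A (𝟙̂ ×̂ A)
  lu⁻¹G A = gr (lu⁻¹ₜ A)
  ruG : ∀ A → GraphExpr (A ×̂ 𝟙̂) A
  ruG A = gr (ruₜ A)
  ru⁻¹G : ∀ A → GraphExpr A (A ×̂ 𝟙̂)
  ru⁻¹G A = gr (ru⁻¹ₜ A)
  σG : ∀ A B → GraphExpr (A ×̂ B) (B ×̂ A)
  σG A B = gr (σₜ A B)
  dG : ∀ A → GraphExpr A (A ×̂ A)
  dG A = gr Δₜ
  eG : ∀ A → GraphExpr A 𝟙̂
  eG A = gr !ₜ

  pentagon : ∀ {A B C D} → (α {A} {B} {C} ⊗₁ id {D}) ⨾ α ⨾ (id ⊗₁ α) ≈ α ⨾ α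
  pentagon {A} {B} {C} {D} = solveG
    ((αG (` A) (` B) (` C) ⊗G idG) ⨾G (αG (` A) (` B ×̂ ` C) (` D) ⨾G (idG ⊗G αG (` B) (` C) (` D))))
    (αG (` A ×̂ ` B) (` C) (` D) ⨾G αG (` A) (` B) (` C ×̂ ` D)) refl

  triangle : ∀ {A B} → α {A} {𝕀} {B} ⨾ (id ⊗₁ lu) ≈ ru ⊗₁ id
  triangle {A} {B} = solveG (αG (` A) 𝟙̂ (` B) ⨾G (idG ⊗G luG (` B))) (ruG (` A) ⊗G idG) refl

  hexagon : ∀ {A B C} → α {A} {B} {C} ⨾ σ ⨾ α ≈ (σ ⊗₁ id) ⨾ α ⨾ (id ⊗₁ σ)
  hexagon {A} {B} {C} = solveG
    (αG (` A) (` B) (` C) ⨾G (σG (` A) (` B ×̂ ` C) ⨾G αG (` B) (` C) (` A)))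
    ((σG (` A) (` B) ⊗G idG) ⨾G (αG (` B) (` A) (` C) ⨾G (idG ⊗G σG (` A) (` C)))) refl

  α-iso₁ : ∀ {A B C} → α {A} {B} {C} ⨾ α⁻¹ ≈ id
  α-iso₁ {A} {B} {C} = solveG (αG (` A) (` B) (` C) ⨾G α⁻¹G (` A) (` B) (` C)) idG refl
  α-iso₂ : ∀ {A B C} → α⁻¹ ⨾ α {A} {B} {C} ≈ id
  α-iso₂ {A} {B} {C} = solveG (α⁻¹G (` A) (` B) (` C) ⨾G αG (` A) (` B) (` C)) idG refl
  lu-iso₁ : ∀ {A} → lu {A} ⨾ lu⁻¹ ≈ id
  lu-iso₁ {A} = solveG (luG (` A) ⨾G lu⁻¹G (` A)) idG refl
  lu-iso₂ : ∀ {A} → lu⁻¹ ⨾ lu {A} ≈ id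
  lu-iso₂ {A} = solveG (lu⁻¹G (` A) ⨾G luG (` A)) idG refl
  ru-iso₁ : ∀ {A} → ru {A} ⨾ ru⁻¹ ≈ id
  ru-iso₁ {A} = solveG (ruG (` A) ⨾G ru⁻¹G (` A)) idG refl
  ru-iso₂ : ∀ {A} → ru⁻¹ ⨾ ru {A} ≈ id
  ru-iso₂ {A} = solveG (ru⁻¹G (` A) ⨾G ruG (` A)) idG refl
  σ-invol : ∀ {A B} → σ {A} {B} ⨾ σ ≈ id
  σ-invol {A} {B} = solveG (σG (` A) (` B) ⨾G σG (` B) (` A)) idG refl
  ⊗-id : ∀ {A C} → id {A} ⊗₁ id {C} ≈ id
  ⊗-id {A} {C} = solveG (idG {` A} ⊗G idG {` C}) idG refl

  coassoc : ∀ {A} → d {A} ⨾ (d ⊗₁ id) ⨾ α ≈ d ⨾ (id ⊗₁ d)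
  coassoc {A} = solveG (dG (` A) ⨾G ((dG (` A) ⊗G idG) ⨾G αG (` A) (` A) (` A))) (dG (` A) ⨾G (idG ⊗G dG (` A))) refl
  counitˡ : ∀ {A} → d {A} ⨾ (e ⊗₁ id) ⨾ lu ≈ id
  counitˡ {A} = solveG (dG (` A) ⨾G ((eG (` A) ⊗G idG) ⨾G luG (` A))) idG refl
  counitʳ : ∀ {A} → d {A} ⨾ (id ⊗₁ e) ⨾ ru ≈ id
  counitʳ {A} = solveG (dG (` A) ⨾G ((idG ⊗G eG (` A)) ⨾G ruG (` A))) idG refl
  cocomm : ∀ {A} → d {A} ⨾ σ ≈ d
  cocomm {A} = solveG (dG (` A) ⨾G σG (` A) (` A)) (dG (` A)) refl

  e-⊗ : ∀ {A B} → e {A ⊗₀ B} ≈ (e ⊗₁ e) ⨾ lu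
  e-⊗ {A} {B} = solveG (eG (` A ×̂ ` B)) ((eG (` A) ⊗G eG (` B)) ⨾G luG 𝟙̂) refl

  d-⊗ : ∀ {A B} → d {A ⊗₀ B} ≈ (d ⊗₁ d) ⨾ α ⨾ (id ⊗₁ (α⁻¹ ⨾ (σ ⊗₁ id) ⨾ α)) ⨾ α⁻¹
  d-⊗ {A} {B} = solveG (dG (a ×̂ b))
    ((dG a ⊗G dG b) ⨾G (αG a a (b ×̂ b) ⨾G ((idG ⊗G (α⁻¹G a b b ⨾G ((σG a b ⊗G idG) ⨾G αG b a b))) ⨾G α⁻¹G a b (a ×̂ b)))) refl
    where
      a b : Ty
      a = ` A
      b = ` B

  identityˡ : ∀ {A B} (f : Hom A B) → id ⨾ f ≈ f
  identityˡ {A} {B} f = L.Eq.trans (comp-cong idF (ΓF idₜ) F F (solveF (idF {` A}) (ΓF idₜ) refl) L.Eq.refl)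
    (L.Eq.trans (graph-⨾ {` A} {` A} {` B} idₜ f) (solveF (F [ idₜ ⁂ₜ idₜ ]f) F refl))
    where
      F : Fm (` A ×̂ ` B)
      F = lift f

  identityʳ : ∀ {A B} (f : Hom A B) → f ⨾ id ≈ f
  identityʳ {A} {B} f = L.Eq.trans (comp-cong F F idF (cographF idₜ) L.Eq.refl (solveF (idF {` B}) (cographF idₜ) refl))
    (L.Eq.trans (⨾-cograph {` A} {` B} {` B} f idₜ) (solveF (F [ idₜ ⁂ₜ idₜ ]f) F refl))
    where
      F : Fm (` A ×̂ ` B)
      F = lift f

  ⨾-mono : ∀ {A B C} {f f' : Hom A B} {g g' : Hom B C} → f ≤ f' → g ≤ g' → f ⨾ g ≤ f' ⨾ g'
  ⨾-mono {A} {B} {C} {f} {f'} {g} {g'} = comp-mono {` A} {` B} {` C} (lift f) (lift f') (lift g) (lift g')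

  ⊗-mono : ∀ {A B C D} {f f' : Hom A B} {g g' : Hom C D} → f ≤ f' → g ≤ g' → f ⊗₁ g ≤ f' ⊗₁ g'
  ⊗-mono {A} {B} {C} {D} {f} {f'} {g} {g'} = tens-mono {` A} {` B} {` C} {` D} (lift f) (lift f') (lift g) (lift g')

  -- Naturality of a structural isomorphism t with inverse k: both sides reduce to a
  -- reindexing of the tensor, (t ⁂ id) on one side and (id ⁂ k) on the other.
  α-nat : ∀ {A B C A' B' C'} (f : Hom A A') (g : Hom B B') (k : Hom C C') →
          ((f ⊗₁ g) ⊗₁ k) ⨾ α ≈ α ⨾ (f ⊗₁ (g ⊗₁ k))
  α-nat {A} {B} {C} {A'} {B'} {C'} f g k =
    L.Eq.trans (⨾-graph-iso {(a ×̂ b) ×̂ c'} ⟦ T₁ ⟧F (αₜ a' b' c'') (α⁻¹ₜ a' b' c'') refl refl)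
    (L.Eq.trans (solveF-via (T₁ [ idₜ ⁂ₜ α⁻¹ₜ a' b' c'' ]f) (T₂ [ αₜ a b c' ⁂ₜ idₜ ]f)
                     ((F [ ⟨ xa , ya ⟩ₜ ]f ∧f G [ ⟨ xb , yb ⟩ₜ ]f) ∧f K [ ⟨ xc , yc ⟩ₜ ]f)
                     (F [ ⟨ xa , ya ⟩ₜ ]f ∧f (G [ ⟨ xb , yb ⟩ₜ ]f ∧f K [ ⟨ xc , yc ⟩ₜ ]f)) refl refl
                     (MS.∧-assoc _ _ _))
    (L.Eq.sym (graph-⨾ {Z = a' ×̂ (b' ×̂ c'')} (αₜ a b c') ⟦ T₂ ⟧F)))
    where
      a = ` A
      b = ` B
      c' = ` C
      a' = ` A'
      b' = ` B'
      c'' = ` C'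
      F : Fm (a ×̂ a')
      F = lift f
      G : Fm (b ×̂ b')
      G = lift g
      K : Fm (c' ×̂ c'')
      K = lift k
      T₁ = tensF (tensF F G) K
      T₂ = tensF F (tensF G K)
      Γ₀ = ((a ×̂ b) ×̂ c') ×̂ (a' ×̂ (b' ×̂ c''))
      xa : Tm Γ₀ a
      xa = p₁ ∘ₜ p₁ ∘ₜ p₁
      xb : Tm Γ₀ b
      xb = p₂ ∘ₜ p₁ ∘ₜ p₁
      xc : Tm Γ₀ c'
      xc = p₂ ∘ₜ p₁
      ya : Tm Γ₀ a'
      ya = p₁ ∘ₜ p₂
      yb : Tm Γ₀ b'
      yb = p₁ ∘ₜ p₂ ∘ₜ p₂
      yc : Tm Γ₀ c''
      yc = p₂ ∘ₜ p₂ ∘ₜ p₂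

  ∧-eq𝟙ˡ : ∀ {Γ} (φ : Fm Γ) → ⟦ EqF {Γ} {𝟙̂} !ₜ !ₜ ∧f φ ⟧F ≈ₚ ⟦ φ ⟧F
  ∧-eq𝟙ˡ {Γ} φ = antisym ∧-snd (∧-intro (⊤≤⇒≤ (eq-𝟙 (!ₜ {Γ}) !ₜ)) ≤-refl)

  ∧-eq𝟙ʳ : ∀ {Γ} (φ : Fm Γ) → ⟦ φ ∧f EqF {Γ} {𝟙̂} !ₜ !ₜ ⟧F ≈ₚ ⟦ φ ⟧F
  ∧-eq𝟙ʳ {Γ} φ = antisym ∧-fst (∧-intro ≤-refl (⊤≤⇒≤ (eq-𝟙 (!ₜ {Γ}) !ₜ)))

  lu-nat : ∀ {A B} (f : Hom A B) → (id {𝕀} ⊗₁ f) ⨾ lu ≈ lu ⨾ f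
  lu-nat {A} {B} f =
    L.Eq.trans (⨾-graph-iso {𝟙̂ ×̂ a} ⟦ T ⟧F (luₜ b) (lu⁻¹ₜ b) refl refl)
    (L.Eq.trans (solveF-via (T [ idₜ ⁂ₜ lu⁻¹ₜ b ]f) (F [ luₜ a ⁂ₜ idₜ ]f)
                     (EqF !ₜ !ₜ ∧f F [ m ]f) (F [ m ]f) refl refl (∧-eq𝟙ˡ (F [ m ]f)))
    (L.Eq.sym (graph-⨾ {Z = b} (luₜ a) f)))
    where
      a = ` A
      b = ` B
      F : Fm (a ×̂ b)
      F = lift f
      T = tensF (idF {𝟙̂}) F
      m : Tm ((𝟙̂ ×̂ a) ×̂ b) (a ×̂ b)
      m = ⟨ p₂ ∘ₜ p₁ , p₂ ⟩ₜ

  ru-nat : ∀ {A B} (f : Hom A B) → (f ⊗₁ id {𝕀}) ⨾ ru ≈ ru ⨾ f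
  ru-nat {A} {B} f =
    L.Eq.trans (⨾-graph-iso {a ×̂ 𝟙̂} ⟦ T ⟧F (ruₜ b) (ru⁻¹ₜ b) refl refl)
    (L.Eq.trans (solveF-via (T [ idₜ ⁂ₜ ru⁻¹ₜ b ]f) (F [ ruₜ a ⁂ₜ idₜ ]f)
                     (F [ m ]f ∧f EqF !ₜ !ₜ) (F [ m ]f) refl refl (∧-eq𝟙ʳ (F [ m ]f)))
    (L.Eq.sym (graph-⨾ {Z = b} (ruₜ a) f)))
    where
      a = ` A
      b = ` B
      F : Fm (a ×̂ b)
      F = lift f
      T = tensF F (idF {𝟙̂})
      m : Tm ((a ×̂ 𝟙̂) ×̂ b) (a ×̂ b)
      m = ⟨ p₁ ∘ₜ p₁ , p₂ ⟩ₜ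

  σ-nat : ∀ {A B A' B'} (f : Hom A A') (g : Hom B B') → (f ⊗₁ g) ⨾ σ ≈ σ ⨾ (g ⊗₁ f)
  σ-nat {A} {B} {A'} {B'} f g =
    L.Eq.trans (⨾-graph-iso {a ×̂ b} ⟦ T₁ ⟧F (σₜ a' b') (σₜ b' a') refl refl)
    (L.Eq.trans (solveF-via (T₁ [ idₜ ⁂ₜ σₜ b' a' ]f) (T₂ [ σₜ a b ⁂ₜ idₜ ]f)
                     (F [ mf ]f ∧f G [ mg ]f) (G [ mg ]f ∧f F [ mf ]f) refl refl (MS.∧-comm _ _))
    (L.Eq.sym (graph-⨾ {Z = b' ×̂ a'} (σₜ a b) ⟦ T₂ ⟧F)))
    where
      a = ` A
      b = ` B
      a' = ` A'
      b' = ` B'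
      F : Fm (a ×̂ a')
      F = lift f
      G : Fm (b ×̂ b')
      G = lift g
      T₁ = tensF F G
      T₂ = tensF G F
      mf : Tm ((a ×̂ b) ×̂ (b' ×̂ a')) (a ×̂ a')
      mf = ⟨ p₁ ∘ₜ p₁ , p₂ ∘ₜ p₂ ⟩ₜ
      mg : Tm ((a ×̂ b) ×̂ (b' ×̂ a')) (b ×̂ b')
      mg = ⟨ p₂ ∘ₜ p₁ , p₁ ∘ₜ p₂ ⟩ₜ

  module Associativity {A B C D : Obj} (f : Hom A B) (g : Hom B C) (k : Hom C D) where
    private
      F : Fm (` A ×̂ ` B)
      F = lift f
      G : Fm (` B ×̂ ` C)
      G = lift g
      K : Fm (` C ×̂ ` D)
      K = lift k

    ⨾-assocˡ : (f ⨾ g) ⨾ k ≤ f ⨾ (g ⨾ k)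
    ⨾-assocˡ = ∃-elim (compBody (compF F G) K) (compF F (compF G K)) (prf (
      compBody (compF F G) K ≡⟦ refl ⟧
      ∃f φ ∧f ψ ≤⟦ ∃-elimˡ φ ψ (compF F (compF G K) [ p₂ ]f) (prf (
        φ ∧f ψ [ p₂ ]f ≡⟦ refl ⟧
        (F [ ⟨ x , y ⟩ₜ ]f ∧f G [ ⟨ y , z ⟩ₜ ]f) ∧f K [ ⟨ z , w ⟩ₜ ]f ≤⟦ ≈⇒≤ (MS.∧-assoc _ _ _) ⟧
        F [ ⟨ x , y ⟩ₜ ]f ∧f (G [ ⟨ y , z ⟩ₜ ]f ∧f K [ ⟨ z , w ⟩ₜ ]f) ≡⟦ refl ⟧
        F [ ⟨ x , y ⟩ₜ ]f ∧f compBody G K [ ⟨ z , ⟨ y , w ⟩ₜ ⟩ₜ ]f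
          ≤⟦ ∧-mono ≤-refl (∃-intro-at (compBody G K) z ⟨ y , w ⟩ₜ) ⟧
        F [ ⟨ x , y ⟩ₜ ]f ∧f compF G K [ ⟨ y , w ⟩ₜ ]f ≡⟦ refl ⟧
        compBody F (compF G K) [ ⟨ y , ⟨ x , w ⟩ₜ ⟩ₜ ]f ≤⟦ ∃-intro-at (compBody F (compF G K)) y ⟨ x , w ⟩ₜ ⟧
        compF F (compF G K) [ ⟨ x , w ⟩ₜ ]f ≡⟦ refl ⟧
        compF F (compF G K) [ p₂ ]f [ p₂ ]f ∎F)) ⟧
      compF F (compF G K) [ p₂ ]f ∎F))
      where
        φ : Fm (` B ×̂ (` C ×̂ (` A ×̂ ` D)))
        φ = compBody F G [ idₜ ⁂ₜ ⟨ p₁ ∘ₜ p₂ , p₁ ⟩ₜ ]f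
        ψ : Fm (` C ×̂ (` A ×̂ ` D))
        ψ = K [ ⟨ p₁ , p₂ ∘ₜ p₂ ⟩ₜ ]f
        x : Tm (` B ×̂ (` C ×̂ (` A ×̂ ` D))) (` A)
        x = p₁ ∘ₜ p₂ ∘ₜ p₂
        y : Tm (` B ×̂ (` C ×̂ (` A ×̂ ` D))) (` B)
        y = p₁
        z : Tm (` B ×̂ (` C ×̂ (` A ×̂ ` D))) (` C)
        z = p₁ ∘ₜ p₂
        w : Tm (` B ×̂ (` C ×̂ (` A ×̂ ` D))) (` D)
        w = p₂ ∘ₜ p₂ ∘ₜ p₂

    ⨾-assocʳ : f ⨾ (g ⨾ k) ≤ (f ⨾ g) ⨾ k
    ⨾-assocʳ = ∃-elim (compBody F (compF G K)) (compF (compF F G) K) (prf (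
      compBody F (compF G K) ≡⟦ refl ⟧
      ψ ∧f ∃f φ ≤⟦ ∃-elimʳ ψ φ (compF (compF F G) K [ p₂ ]f) (prf (
        ψ [ p₂ ]f ∧f φ ≡⟦ refl ⟧
        F [ ⟨ x , y ⟩ₜ ]f ∧f (G [ ⟨ y , z ⟩ₜ ]f ∧f K [ ⟨ z , w ⟩ₜ ]f) ≤⟦ ≈⇒≥ (MS.∧-assoc _ _ _) ⟧
        (F [ ⟨ x , y ⟩ₜ ]f ∧f G [ ⟨ y , z ⟩ₜ ]f) ∧f K [ ⟨ z , w ⟩ₜ ]f ≡⟦ refl ⟧
        compBody F G [ ⟨ y , ⟨ x , z ⟩ₜ ⟩ₜ ]f ∧f K [ ⟨ z , w ⟩ₜ ]f
          ≤⟦ ∧-mono (∃-intro-at (compBody F G) y ⟨ x , z ⟩ₜ) ≤-refl ⟧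
        compF F G [ ⟨ x , z ⟩ₜ ]f ∧f K [ ⟨ z , w ⟩ₜ ]f ≡⟦ refl ⟧
        compBody (compF F G) K [ ⟨ z , ⟨ x , w ⟩ₜ ⟩ₜ ]f ≤⟦ ∃-intro-at (compBody (compF F G) K) z ⟨ x , w ⟩ₜ ⟧
        compF (compF F G) K [ ⟨ x , w ⟩ₜ ]f ≡⟦ refl ⟧
        compF (compF F G) K [ p₂ ]f [ p₂ ]f ∎F)) ⟧
      compF (compF F G) K [ p₂ ]f ∎F))
      where
        ψ : Fm (` B ×̂ (` A ×̂ ` D))
        ψ = F [ ⟨ p₁ ∘ₜ p₂ , p₁ ⟩ₜ ]f
        φ : Fm (` C ×̂ (` B ×̂ (` A ×̂ ` D)))
        φ = compBody G K [ idₜ ⁂ₜ ⟨ p₁ , p₂ ∘ₜ p₂ ⟩ₜ ]f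
        x : Tm (` C ×̂ (` B ×̂ (` A ×̂ ` D))) (` A)
        x = p₁ ∘ₜ p₂ ∘ₜ p₂
        y : Tm (` C ×̂ (` B ×̂ (` A ×̂ ` D))) (` B)
        y = p₁ ∘ₜ p₂
        z : Tm (` C ×̂ (` B ×̂ (` A ×̂ ` D))) (` C)
        z = p₁
        w : Tm (` C ×̂ (` B ×̂ (` A ×̂ ` D))) (` D)
        w = p₂ ∘ₜ p₂ ∘ₜ p₂

  open Associativity using (⨾-assocˡ; ⨾-assocʳ)

  module Interchange {A B C A' B' C' : Obj} (f : Hom A B) (g : Hom B C) (f' : Hom A' B') (g' : Hom B' C') where
    private
      F : Fm (` A ×̂ ` B)
      F = lift f
      G : Fm (` B ×̂ ` C)
      G = lift g
      F' : Fm (` A' ×̂ ` B')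
      F' = lift f'
      G' : Fm (` B' ×̂ ` C')
      G' = lift g'
      Γ₀ = (` A ×̂ ` A') ×̂ (` C ×̂ ` C')

    ⊗-⨾ˡ : (f ⨾ g) ⊗₁ (f' ⨾ g') ≤ (f ⊗₁ f') ⨾ (g ⊗₁ g')
    ⊗-⨾ˡ = prf (
      tensF (compF F G) (compF F' G') ≡⟦ refl ⟧
      ∃f φ ∧f ψ ≤⟦ ∃-elimˡ φ ψ RHS (prf (
        φ ∧f ψ [ p₂ ]f ≡⟦ refl ⟧
        φ ∧f ∃f φ' ≤⟦ ∃-elimʳ φ φ' (RHS [ p₂ ]f) (prf (
          φ [ p₂ ]f ∧f φ' ≡⟦ refl ⟧
          (F [ ⟨ x , y ⟩ₜ ]f ∧f G [ ⟨ y , z ⟩ₜ ]f) ∧f (F' [ ⟨ x' , y' ⟩ₜ ]f ∧f G' [ ⟨ y' , z' ⟩ₜ ]f)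
            ≤⟦ ∧-interchange ⟧
          (F [ ⟨ x , y ⟩ₜ ]f ∧f F' [ ⟨ x' , y' ⟩ₜ ]f) ∧f (G [ ⟨ y , z ⟩ₜ ]f ∧f G' [ ⟨ y' , z' ⟩ₜ ]f) ≡⟦ refl ⟧
          compBody (tensF F F') (tensF G G') [ ⟨ ⟨ y , y' ⟩ₜ , p₂ ∘ₜ p₂ ⟩ₜ ]f
            ≤⟦ ∃-intro-at (compBody (tensF F F') (tensF G G')) ⟨ y , y' ⟩ₜ (p₂ ∘ₜ p₂) ⟧
          RHS [ p₂ ∘ₜ p₂ ]f ≡⟦ refl ⟧
          RHS [ p₂ ]f [ p₂ ]f ∎F)) ⟧
        RHS [ p₂ ]f ∎F)) ⟧
      RHS ∎F)
      where
        RHS = compF (tensF F F') (tensF G G')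
        φ : Fm (` B ×̂ Γ₀)
        φ = compBody F G [ idₜ ⁂ₜ ⟨ p₁ ∘ₜ p₁ , p₁ ∘ₜ p₂ ⟩ₜ ]f
        ψ : Fm Γ₀
        ψ = compF F' G' [ ⟨ p₂ ∘ₜ p₁ , p₂ ∘ₜ p₂ ⟩ₜ ]f
        φ' : Fm (` B' ×̂ (` B ×̂ Γ₀))
        φ' = compBody F' G' [ idₜ ⁂ₜ ⟨ p₂ ∘ₜ p₁ ∘ₜ p₂ , p₂ ∘ₜ p₂ ∘ₜ p₂ ⟩ₜ ]f
        y' : Tm (` B' ×̂ (` B ×̂ Γ₀)) (` B')
        y' = p₁
        y : Tm (` B' ×̂ (` B ×̂ Γ₀)) (` B)
        y = p₁ ∘ₜ p₂
        x : Tm (` B' ×̂ (` B ×̂ Γ₀)) (` A)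
        x = p₁ ∘ₜ p₁ ∘ₜ p₂ ∘ₜ p₂
        x' : Tm (` B' ×̂ (` B ×̂ Γ₀)) (` A')
        x' = p₂ ∘ₜ p₁ ∘ₜ p₂ ∘ₜ p₂
        z : Tm (` B' ×̂ (` B ×̂ Γ₀)) (` C)
        z = p₁ ∘ₜ p₂ ∘ₜ p₂ ∘ₜ p₂
        z' : Tm (` B' ×̂ (` B ×̂ Γ₀)) (` C')
        z' = p₂ ∘ₜ p₂ ∘ₜ p₂ ∘ₜ p₂

    ⊗-⨾ʳ : (f ⊗₁ f') ⨾ (g ⊗₁ g') ≤ (f ⨾ g) ⊗₁ (f' ⨾ g')
    ⊗-⨾ʳ = ∃-elim (compBody (tensF F F') (tensF G G')) (tensF (compF F G) (compF F' G')) (prf (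
      compBody (tensF F F') (tensF G G') ≡⟦ refl ⟧
      (F [ ⟨ x , y ⟩ₜ ]f ∧f F' [ ⟨ x' , y' ⟩ₜ ]f) ∧f (G [ ⟨ y , z ⟩ₜ ]f ∧f G' [ ⟨ y' , z' ⟩ₜ ]f) ≤⟦ ∧-interchange ⟧
      (F [ ⟨ x , y ⟩ₜ ]f ∧f G [ ⟨ y , z ⟩ₜ ]f) ∧f (F' [ ⟨ x' , y' ⟩ₜ ]f ∧f G' [ ⟨ y' , z' ⟩ₜ ]f) ≡⟦ refl ⟧
      compBody F G [ ⟨ y , ⟨ x , z ⟩ₜ ⟩ₜ ]f ∧f compBody F' G' [ ⟨ y' , ⟨ x' , z' ⟩ₜ ⟩ₜ ]f
        ≤⟦ ∧-mono (∃-intro-at (compBody F G) y ⟨ x , z ⟩ₜ) (∃-intro-at (compBody F' G') y' ⟨ x' , z' ⟩ₜ) ⟧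
      compF F G [ ⟨ x , z ⟩ₜ ]f ∧f compF F' G' [ ⟨ x' , z' ⟩ₜ ]f ≡⟦ refl ⟧
      tensF (compF F G) (compF F' G') [ p₂ ]f ∎F))
      where
        y : Tm ((` B ×̂ ` B') ×̂ Γ₀) (` B)
        y = p₁ ∘ₜ p₁
        y' : Tm ((` B ×̂ ` B') ×̂ Γ₀) (` B')
        y' = p₂ ∘ₜ p₁
        x : Tm ((` B ×̂ ` B') ×̂ Γ₀) (` A)
        x = p₁ ∘ₜ p₁ ∘ₜ p₂
        x' : Tm ((` B ×̂ ` B') ×̂ Γ₀) (` A')
        x' = p₂ ∘ₜ p₁ ∘ₜ p₂
        z : Tm ((` B ×̂ ` B') ×̂ Γ₀) (` C)
        z = p₁ ∘ₜ p₂ ∘ₜ p₂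
        z' : Tm ((` B ×̂ ` B') ×̂ Γ₀) (` C')
        z' = p₂ ∘ₜ p₂ ∘ₜ p₂

  open Interchange using (⊗-⨾ˡ; ⊗-⨾ʳ)

  d*F : ∀ A → Fm ((A ×̂ A) ×̂ A)
  d*F A = lift {(A ×̂ A) ×̂ (A ×̂ A)} (δ ⟦ A ×̂ A ⟧) [ idₜ ⁂ₜ Δₜ ]f

  d* : ∀ {A} → Hom (A ⊗₀ A) A
  d* {A} = ⟦ d*F (` A) ⟧F

  e* : ∀ {A} → Hom 𝕀 A
  e* = ⊤ₚ

  d-unit : ∀ {A} → id ≤ d {A} ⨾ d*
  d-unit {A} = prf (
    idF {a} ≡⟦ refl ⟧
    EqF p₁ p₂ ≤⟦ ∧-intro (⊤≤⇒≤ (eq-refl u)) (∧-intro ≤-refl ≤-refl) ⟧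
    EqF u u ∧f (EqF p₁ p₂ ∧f EqF p₁ p₂) ≡⟦ refl ⟧
    EqF u u ∧f (EqF (p₁ ∘ₜ u) (p₁ ∘ₜ v) ∧f EqF (p₂ ∘ₜ u) (p₂ ∘ₜ v)) ≤⟦ ∧-mono ≤-refl (eq-×-join u v) ⟧
    EqF u u ∧f EqF u v ≡⟦ refl ⟧
    compBody (ΓF Δₜ) (d*F a) [ ⟨ u , idₜ ⟩ₜ ]f ≤⟦ ∃-intro (compBody (ΓF Δₜ) (d*F a)) u ⟧
    compF (ΓF Δₜ) (d*F a) ∎F)
    where
      a = ` A
      u v : Tm (a ×̂ a) (a ×̂ a)
      u = ⟨ p₁ , p₁ ⟩ₜ
      v = ⟨ p₂ , p₂ ⟩ₜ

  d-counit : ∀ {A} → d* ⨾ d {A} ≤ id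
  d-counit {A} = ∃-elim (compBody (d*F a) (ΓF Δₜ)) (idF {a ×̂ a}) (prf (
    compBody (d*F a) (ΓF Δₜ) ≡⟦ refl ⟧
    EqF (p₁ ∘ₜ p₂) xx ∧f EqF xx (p₂ ∘ₜ p₂) ≤⟦ eq-trans (p₁ ∘ₜ p₂) xx (p₂ ∘ₜ p₂) ⟧
    EqF (p₁ ∘ₜ p₂) (p₂ ∘ₜ p₂) ≡⟦ refl ⟧
    idF [ p₂ ]f ∎F))
    where
      a = ` A
      xx : Tm (a ×̂ ((a ×̂ a) ×̂ (a ×̂ a))) (a ×̂ a)
      xx = ⟨ p₁ , p₁ ⟩ₜ

  e-unit : ∀ {A} → id ≤ e {A} ⨾ e*
  e-unit {A} = prf (
    idF {a} ≤⟦ ∧-intro (⊤≤⇒≤ (eq-𝟙 (!ₜ {a ×̂ a}) !ₜ)) ⊤-max ⟧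
    EqF !ₜ !ₜ ∧f ⊤f ≡⟦ refl ⟧
    compBody {a} {Z = a} (ΓF !ₜ) ⊤f [ ⟨ !ₜ , idₜ ⟩ₜ ]f ≤⟦ ∃-intro (compBody {a} {Z = a} (ΓF !ₜ) ⊤f) !ₜ ⟧
    compF {Z = a} (ΓF !ₜ) ⊤f ∎F)
    where
      a = ` A

  e-counit : ∀ {A} → e* ⨾ e {A} ≤ id
  e-counit = ⊤≤⇒≤ (≤-trans (eq-𝟙 (p₁ {𝟙̂} {𝟙̂}) p₂) (solveF-≤ (EqF (p₁ {𝟙̂} {𝟙̂}) p₂) (idF {𝟙̂}) refl))

  e-lax : ∀ {A B} (R : Hom A B) → R ⨾ e ≤ e
  e-lax {A} R = ⊤≤⇒≤ (≤-trans (eq-𝟙 (!ₜ ∘ₜ p₁ {` A} {𝟙̂}) p₂) (solveF-≤ (EqF (!ₜ ∘ₜ p₁ {` A} {𝟙̂}) p₂) (ΓF !ₜ) refl))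

  d-lax : ∀ {A B} (R : Hom A B) → R ⨾ d ≤ d ⨾ (R ⊗₁ R)
  d-lax {A} {B} R = ∃-elim (compBody Rf (ΓF Δₜ)) RHS (prf (
    compBody Rf (ΓF Δₜ) ≡⟦ refl ⟧
    Rf [ ⟨ x , y ⟩ₜ ]f ∧f EqF ⟨ y , y ⟩ₜ w ≤⟦ ∧-mono ≤-refl (eq-×-split ⟨ y , y ⟩ₜ w) ⟧
    Rf [ ⟨ x , y ⟩ₜ ]f ∧f (EqF (p₁ ∘ₜ ⟨ y , y ⟩ₜ) (p₁ ∘ₜ w) ∧f EqF (p₂ ∘ₜ ⟨ y , y ⟩ₜ) (p₂ ∘ₜ w)) ≡⟦ refl ⟧
    Rf [ ⟨ x , y ⟩ₜ ]f ∧f (EqF y w₁ ∧f EqF y w₂)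
      ≤⟦ ∧-intro (∧-intro (≤-trans ∧-snd ∧-fst) ∧-fst) (∧-intro (≤-trans ∧-snd ∧-snd) ∧-fst) ⟧
    (EqF y w₁ ∧f Rf [ ⟨ x , y ⟩ₜ ]f) ∧f (EqF y w₂ ∧f Rf [ ⟨ x , y ⟩ₜ ]f)
      ≤⟦ ∧-mono (leibniz Rf x y w₁) (leibniz Rf x y w₂) ⟧
    Rf [ ⟨ x , w₁ ⟩ₜ ]f ∧f Rf [ ⟨ x , w₂ ⟩ₜ ]f ≤⟦ ∧-intro (⊤≤⇒≤ (eq-refl ⟨ x , x ⟩ₜ)) ≤-refl ⟧
    EqF ⟨ x , x ⟩ₜ ⟨ x , x ⟩ₜ ∧f (Rf [ ⟨ x , w₁ ⟩ₜ ]f ∧f Rf [ ⟨ x , w₂ ⟩ₜ ]f) ≡⟦ refl ⟧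
    compBody (ΓF Δₜ) (tensF Rf Rf) [ ⟨ ⟨ x , x ⟩ₜ , p₂ ⟩ₜ ]f
      ≤⟦ ∃-intro-at (compBody (ΓF Δₜ) (tensF Rf Rf)) ⟨ x , x ⟩ₜ p₂ ⟧
    RHS [ p₂ ]f ∎F))
    where
      a = ` A
      b = ` B
      Rf : Fm (a ×̂ b)
      Rf = lift R
      RHS = compF (ΓF Δₜ) (tensF Rf Rf)
      y : Tm (b ×̂ (a ×̂ (b ×̂ b))) b
      y = p₁
      x : Tm (b ×̂ (a ×̂ (b ×̂ b))) a
      x = p₁ ∘ₜ p₂
      w : Tm (b ×̂ (a ×̂ (b ×̂ b))) (b ×̂ b)
      w = p₂ ∘ₜ p₂
      w₁ w₂ : Tm (b ×̂ (a ×̂ (b ×̂ b))) b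
      w₁ = p₁ ∘ₜ w
      w₂ = p₂ ∘ₜ w

  -- Both sides of the Frobenius law express that the four variables of (A × A) × (A × A) are equal.
  module FrobeniusLaw {A : Obj} where
    private
      a = ` A
      T : Fm ((a ×̂ (a ×̂ a)) ×̂ (a ×̂ a))
      T = tensF (idF {a}) (d*F a)
      lhsF : Fm ((a ×̂ a) ×̂ (a ×̂ a))
      lhsF = T [ αₜ a a a ⁂ₜ idₜ ]f [ (Δₜ ⁂ₜ idₜ) ⁂ₜ idₜ ]f

    lhs≈lhsF : (d {A} ⊗₁ id) ⨾ α ⨾ (id ⊗₁ d*) ≈ ⟦ lhsF ⟧F
    lhs≈lhsF = L.Eq.trans
      (comp-cong ⟦ dG a ⊗G idG {a} ⟧G (ΓF (Δₜ ⁂ₜ idₜ)) (compF (ΓF (αₜ a a a)) T) (lift ⟦ T [ αₜ a a a ⁂ₜ idₜ ]f ⟧F)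
                 (GraphExpr≈graph (dG a ⊗G idG {a})) (graph-⨾ {Z = a ×̂ a} (αₜ a a a) ⟦ T ⟧F))
      (graph-⨾ {Z = a ×̂ a} (Δₜ {a} ⁂ₜ idₜ {a}) ⟦ T [ αₜ a a a ⁂ₜ idₜ ]f ⟧F)

    lhsF≤d*⨾d : ⟦ lhsF ⟧F ≤ₚ d* ⨾ d {A}
    lhsF≤d*⨾d = prf (
      lhsF ≡⟦ refl ⟧
      EqF s u ∧f EqF ⟨ s , t ⟩ₜ ⟨ v , v ⟩ₜ ≤⟦ ∧-mono ≤-refl (eq-×-split ⟨ s , t ⟩ₜ ⟨ v , v ⟩ₜ) ⟧
      EqF s u ∧f (EqF (p₁ ∘ₜ ⟨ s , t ⟩ₜ) (p₁ ∘ₜ ⟨ v , v ⟩ₜ) ∧f EqF (p₂ ∘ₜ ⟨ s , t ⟩ₜ) (p₂ ∘ₜ ⟨ v , v ⟩ₜ)) ≡⟦ refl ⟧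
      EqF s u ∧f (EqF s v ∧f EqF t v) ≤⟦ ∧-intro ∧-snd (∧-intro
           (≤-trans (∧-intro (≤-trans ∧-snd (≤-trans ∧-fst (eq-sym s v))) ∧-fst) (eq-trans v s u))
           (⊤≤⇒≤ (eq-refl v))) ⟧
      (EqF s v ∧f EqF t v) ∧f (EqF v u ∧f EqF v v) ≡⟦ refl ⟧
      (EqF (p₁ ∘ₜ ⟨ s , t ⟩ₜ) (p₁ ∘ₜ ⟨ v , v ⟩ₜ) ∧f EqF (p₂ ∘ₜ ⟨ s , t ⟩ₜ) (p₂ ∘ₜ ⟨ v , v ⟩ₜ)) ∧f
      (EqF (p₁ ∘ₜ ⟨ v , v ⟩ₜ) (p₁ ∘ₜ ⟨ u , v ⟩ₜ) ∧f EqF (p₂ ∘ₜ ⟨ v , v ⟩ₜ) (p₂ ∘ₜ ⟨ u , v ⟩ₜ))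
        ≤⟦ ∧-mono (eq-×-join ⟨ s , t ⟩ₜ ⟨ v , v ⟩ₜ) (eq-×-join ⟨ v , v ⟩ₜ ⟨ u , v ⟩ₜ) ⟧
      EqF ⟨ s , t ⟩ₜ ⟨ v , v ⟩ₜ ∧f EqF ⟨ v , v ⟩ₜ ⟨ u , v ⟩ₜ ≡⟦ refl ⟧
      compBody (d*F a) (ΓF Δₜ) [ ⟨ v , idₜ ⟩ₜ ]f ≤⟦ ∃-intro (compBody (d*F a) (ΓF Δₜ)) v ⟧
      compF (d*F a) (ΓF Δₜ) ∎F)
      where
        s t u v : Tm ((a ×̂ a) ×̂ (a ×̂ a)) a
        s = p₁ ∘ₜ p₁
        t = p₂ ∘ₜ p₁
        u = p₁ ∘ₜ p₂
        v = p₂ ∘ₜ p₂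

    d*⨾d≤lhsF : d* ⨾ d {A} ≤ ⟦ lhsF ⟧F
    d*⨾d≤lhsF = ∃-elim (compBody (d*F a) (ΓF Δₜ)) lhsF (prf (
      compBody (d*F a) (ΓF Δₜ) ≡⟦ refl ⟧
      EqF ⟨ s , t ⟩ₜ ⟨ x , x ⟩ₜ ∧f EqF ⟨ x , x ⟩ₜ ⟨ u , v ⟩ₜ
        ≤⟦ ∧-mono (eq-×-split ⟨ s , t ⟩ₜ ⟨ x , x ⟩ₜ) (eq-×-split ⟨ x , x ⟩ₜ ⟨ u , v ⟩ₜ) ⟧
      (EqF (p₁ ∘ₜ ⟨ s , t ⟩ₜ) (p₁ ∘ₜ ⟨ x , x ⟩ₜ) ∧f EqF (p₂ ∘ₜ ⟨ s , t ⟩ₜ) (p₂ ∘ₜ ⟨ x , x ⟩ₜ)) ∧f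
      (EqF (p₁ ∘ₜ ⟨ x , x ⟩ₜ) (p₁ ∘ₜ ⟨ u , v ⟩ₜ) ∧f EqF (p₂ ∘ₜ ⟨ x , x ⟩ₜ) (p₂ ∘ₜ ⟨ u , v ⟩ₜ)) ≡⟦ refl ⟧
      (EqF s x ∧f EqF t x) ∧f (EqF x u ∧f EqF x v)
        ≤⟦ ∧-intro (≤-trans (∧-mono ∧-fst ∧-fst) (eq-trans s x u))
                   (∧-intro (≤-trans (∧-mono ∧-fst ∧-snd) (eq-trans s x v))
                            (≤-trans (∧-mono ∧-snd ∧-snd) (eq-trans t x v))) ⟧
      EqF s u ∧f (EqF s v ∧f EqF t v) ≡⟦ refl ⟧
      EqF s u ∧f (EqF (p₁ ∘ₜ ⟨ s , t ⟩ₜ) (p₁ ∘ₜ ⟨ v , v ⟩ₜ) ∧f EqF (p₂ ∘ₜ ⟨ s , t ⟩ₜ) (p₂ ∘ₜ ⟨ v , v ⟩ₜ))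
        ≤⟦ ∧-mono ≤-refl (eq-×-join ⟨ s , t ⟩ₜ ⟨ v , v ⟩ₜ) ⟧
      EqF s u ∧f EqF ⟨ s , t ⟩ₜ ⟨ v , v ⟩ₜ ≡⟦ refl ⟧
      lhsF [ p₂ ]f ∎F))
      where
        x s t u v : Tm (a ×̂ ((a ×̂ a) ×̂ (a ×̂ a))) a
        x = p₁
        s = p₁ ∘ₜ p₁ ∘ₜ p₂
        t = p₂ ∘ₜ p₁ ∘ₜ p₂
        u = p₁ ∘ₜ p₂ ∘ₜ p₂
        v = p₂ ∘ₜ p₂ ∘ₜ p₂

    frob : (d {A} ⊗₁ id) ⨾ α ⨾ (id ⊗₁ d*) ≈ d* ⨾ d
    frob = L.Eq.trans lhs≈lhsF (antisym lhsF≤d*⨾d d*⨾d≤lhsF)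

  isCartesianBicategory : IsCartesianBicategory (𝒜 𝐏)
  isCartesianBicategory = record
    { isPartialOrder = L.isPartialOrder
    ; ⨾-mono = ⨾-mono
    ; ⊗-mono = ⊗-mono
    ; identityˡ = identityˡ
    ; identityʳ = identityʳ
    ; assoc = λ f g k → antisym (⨾-assocˡ f g k) (⨾-assocʳ f g k)
    ; ⊗-id = ⊗-id
    ; ⊗-⨾ = λ f g f' g' → antisym (⊗-⨾ˡ f g f' g') (⊗-⨾ʳ f g f' g')
    ; α-iso₁ = α-iso₁
    ; α-iso₂ = α-iso₂
    ; lu-iso₁ = lu-iso₁
    ; lu-iso₂ = lu-iso₂
    ; ru-iso₁ = ru-iso₁
    ; ru-iso₂ = ru-iso₂
    ; σ-invol = σ-invol
    ; α-nat = α-nat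
    ; lu-nat = lu-nat
    ; ru-nat = ru-nat
    ; σ-nat = σ-nat
    ; pentagon = pentagon
    ; triangle = triangle
    ; hexagon = hexagon
    ; coassoc = coassoc
    ; counitˡ = counitˡ
    ; counitʳ = counitʳ
    ; cocomm = cocomm
    ; d* = d*
    ; e* = e*
    ; d-unit = d-unit
    ; d-counit = d-counit
    ; e-unit = e-unit
    ; e-counit = e-counit
    ; frob = FrobeniusLaw.frob
    ; d-lax = d-lax
    ; e-lax = e-lax
    ; e-⊗ = e-⊗
    ; d-⊗ = d-⊗
    }

-- Unlike trans, trans′ computes when its second argument is refl, which is the
-- case for the identity coercions F₀ ⟦ ` X ⟧ ≡ ⟦ ` F₀ X ⟧ below.
trans′ : ∀ {a} {A : Set a} {x y z : A} → x ≡ y → y ≡ z → x ≡ z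
trans′ p refl = p

module Transport {o h e c ℓ₁ ℓ₂} (D : CartesianCategory o h e) (R : EED D c ℓ₁ ℓ₂) where
  open CartesianCategory D
  open EED R
  module ≈ {A B} = IsEquivalence (≈-equiv {A} {B})

  subst₂-≈ : ∀ {U U' V V'} (p : U ≡ U') (q : V ≡ V') {f g : U ⇒ V} → f ≈ g → subst₂ _⇒_ p q f ≈ subst₂ _⇒_ p q g
  subst₂-≈ refl refl f≈g = f≈g

  subst₂-∘ : ∀ {U U' V V' W W'} (p : U ≡ U') (q : V ≡ V') (r : W ≡ W') (f : V ⇒ W) (g : U ⇒ V) →
             subst₂ _⇒_ q r f ∘ subst₂ _⇒_ p q g ≡ subst₂ _⇒_ p r (f ∘ g)
  subst₂-∘ refl refl refl f g = refl

  subst₂-id : ∀ {U U'} (p : U ≡ U') → subst₂ _⇒_ p p id ≡ id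
  subst₂-id refl = refl

  subst₂-reflʳ : ∀ {W U Y} (r : W ≡ U) (f : W ⇒ Y) → subst₂ _⇒_ r refl f ≡ subst (λ Z → Z ⇒ Y) r f
  subst₂-reflʳ refl f = refl

  subst₂-π₁ : ∀ {U U' V V'} (pA : U ≡ U') (pB : V ≡ V') {W} (r : W ≡ U ×₀ V) (f : W ⇒ U) →
              subst (λ Z → Z ⇒ U) r f ≈ π₁ → subst₂ _⇒_ (trans′ r (cong₂ _×₀_ pA pB)) pA f ≈ π₁
  subst₂-π₁ refl refl r f f≈π₁ = ≈.trans (≈.reflexive (subst₂-reflʳ r f)) f≈π₁

  subst₂-π₂ : ∀ {U U' V V'} (pA : U ≡ U') (pB : V ≡ V') {W} (r : W ≡ U ×₀ V) (f : W ⇒ V) →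
              subst (λ Z → Z ⇒ V) r f ≈ π₂ → subst₂ _⇒_ (trans′ r (cong₂ _×₀_ pA pB)) pB f ≈ π₂
  subst₂-π₂ refl refl r f f≈π₂ = ≈.trans (≈.reflexive (subst₂-reflʳ r f)) f≈π₂

  subst-reindex : ∀ {U U' V V'} (p : U ≡ U') (q : V ≡ V') (g : U ⇒ V) (y : Pred V) →
                  subst Pred p (reindex g y) ≡ reindex (subst₂ _⇒_ p q g) (subst Pred q y)
  subst-reindex refl refl g y = refl

  subst-∧ : ∀ {U U'} (p : U ≡ U') (x y : Pred U) → subst Pred p (x ∧ₚ y) ≡ subst Pred p x ∧ₚ subst Pred p y
  subst-∧ refl x y = refl

  subst-⊤ : ∀ {U U'} (p : U ≡ U') → subst Pred p ⊤ₚ ≡ ⊤ₚ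
  subst-⊤ refl = refl

  subst-≈ₚ : ∀ {U U'} (p : U ≡ U') {x y : Pred U} → x ≈ₚ y → subst Pred p x ≈ₚ subst Pred p y
  subst-≈ₚ refl x≈y = x≈y

  subst-≤ₚ : ∀ {U U'} (p : U ≡ U') {x y : Pred U} → x ≤ₚ y → subst Pred p x ≤ₚ subst Pred p y
  subst-≤ₚ refl x≤y = x≤y

  subst-δ : ∀ {U U'} (p : U ≡ U') → subst Pred (cong₂ _×₀_ p p) (δ U) ≡ δ U'
  subst-δ refl = refl

  subst-∃π : ∀ {X X' G G'} (pX : X ≡ X') (pG : G ≡ G') (y : Pred (X ×₀ G)) →
             subst Pred pG (∃π y) ≡ ∃π (subst Pred (cong₂ _×₀_ pX pG) y)
  subst-∃π refl refl y = refl

  subst-subst′ : ∀ {U V W} (r : U ≡ V) (s : V ≡ W) (z : Pred U) →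
                 subst Pred s (subst Pred r z) ≡ subst Pred (trans′ r s) z
  subst-subst′ r refl z = refl

  subst₂-relation : ∀ {U U' V V'} (p : U ≡ U') (q : V ≡ V') {W} (r : W ≡ U ×₀ V) (x : Pred W) →
                    subst₂ (λ X Y → Pred (X ×₀ Y)) p q (subst Pred r x) ≡ subst Pred (trans′ r (cong₂ _×₀_ p q)) x
  subst₂-relation refl refl r x = refl

  trans-cong-×ˡ : ∀ {U V V' W} (a : U ≡ V ×₀ W) (q : V ≡ V') → trans a (cong (_×₀ W) q) ≡ trans′ a (cong₂ _×₀_ q refl)
  trans-cong-×ˡ a refl = trans-reflʳ a

  trans-cong-×ʳ : ∀ {U V W W'} (a : U ≡ V ×₀ W) (q : W ≡ W') → trans a (cong (V ×₀_) q) ≡ trans′ a (cong₂ _×₀_ refl q)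
  trans-cong-×ʳ a refl = trans-reflʳ a

module Preservation {o h e c ℓ₁ ℓ₂} {𝐏 𝐑 : EEDObj o h e c ℓ₁ ℓ₂} (m : EEDHom 𝐏 𝐑) where
  private
    module C = CartesianCategory (EEDObj.Base 𝐏)
    module D = CartesianCategory (EEDObj.Base 𝐑)
    module P = EED (EEDObj.Doc 𝐏)
    module R = EED (EEDObj.Doc 𝐑)
    module LP = RelationsOf 𝐏
    module LR = RelationsOf 𝐑
    module T = Transport (EEDObj.Base 𝐑) (EEDObj.Doc 𝐑)
  open EEDHom m
  open StrictCartesianFunctor F
  open LP using (`_; _×̂_; 𝟙̂)

  mapTy : LP.Ty → LR.Ty
  mapTy (` X) = LR.` (F₀ X)
  mapTy (A ×̂ B) = mapTy A LR.×̂ mapTy B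
  mapTy 𝟙̂ = LR.𝟙̂

  F₀-⟦⟧ : (A : LP.Ty) → F₀ LP.⟦ A ⟧ ≡ LR.⟦ mapTy A ⟧
  F₀-⟦⟧ (` X) = refl
  F₀-⟦⟧ (A ×̂ B) = trans′ (F-× LP.⟦ A ⟧ LP.⟦ B ⟧) (cong₂ D._×₀_ (F₀-⟦⟧ A) (F₀-⟦⟧ B))
  F₀-⟦⟧ 𝟙̂ = F-𝟙

  F₁⟦⟧ : ∀ A B → LP.⟦ A ⟧ C.⇒ LP.⟦ B ⟧ → LR.⟦ mapTy A ⟧ D.⇒ LR.⟦ mapTy B ⟧
  F₁⟦⟧ A B f = subst₂ D._⇒_ (F₀-⟦⟧ A) (F₀-⟦⟧ B) (F₁ f)

  mapTm : ∀ {A B} → LP.Tm A B → LR.Tm (mapTy A) (mapTy B)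
  mapTm LP.idₜ = LR.idₜ
  mapTm (f LP.∘ₜ g) = mapTm f LR.∘ₜ mapTm g
  mapTm LP.p₁ = LR.p₁
  mapTm LP.p₂ = LR.p₂
  mapTm LP.⟨ f , g ⟩ₜ = LR.⟨ mapTm f , mapTm g ⟩ₜ
  mapTm LP.!ₜ = LR.!ₜ
  mapTm (LP.atom {A} {B} f) = LR.atom (F₁⟦⟧ A B f)

  F₁⟦⟧-π₁ : ∀ A B → F₁⟦⟧ (A ×̂ B) A C.π₁ D.≈ D.π₁
  F₁⟦⟧-π₁ A B = T.subst₂-π₁ (F₀-⟦⟧ A) (F₀-⟦⟧ B) (F-× LP.⟦ A ⟧ LP.⟦ B ⟧) (F₁ C.π₁) F-π₁

  F₁⟦⟧-π₂ : ∀ A B → F₁⟦⟧ (A ×̂ B) B C.π₂ D.≈ D.π₂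
  F₁⟦⟧-π₂ A B = T.subst₂-π₂ (F₀-⟦⟧ A) (F₀-⟦⟧ B) (F-× LP.⟦ A ⟧ LP.⟦ B ⟧) (F₁ C.π₂) F-π₂

  F₁⟦⟧-∘ : ∀ A B C' (f : LP.⟦ B ⟧ C.⇒ LP.⟦ C' ⟧) (g : LP.⟦ A ⟧ C.⇒ LP.⟦ B ⟧) →
           F₁⟦⟧ A C' (f C.∘ g) D.≈ F₁⟦⟧ B C' f D.∘ F₁⟦⟧ A B g
  F₁⟦⟧-∘ A B C' f g = T.≈.trans (T.subst₂-≈ (F₀-⟦⟧ A) (F₀-⟦⟧ C') (F-∘ g f))
    (T.≈.reflexive (sym (T.subst₂-∘ (F₀-⟦⟧ A) (F₀-⟦⟧ B) (F₀-⟦⟧ C') (F₁ f) (F₁ g))))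

  F₁⟦⟧-pair : ∀ X A B (f : LP.⟦ X ⟧ C.⇒ LP.⟦ A ⟧) (g : LP.⟦ X ⟧ C.⇒ LP.⟦ B ⟧) →
              D.π₁ D.∘ F₁⟦⟧ X (A ×̂ B) C.⟨ f , g ⟩ D.≈ F₁⟦⟧ X A f
              × D.π₂ D.∘ F₁⟦⟧ X (A ×̂ B) C.⟨ f , g ⟩ D.≈ F₁⟦⟧ X B g
  F₁⟦⟧-pair X A B f g =
    T.≈.trans (D.∘-resp-≈ (T.≈.sym (F₁⟦⟧-π₁ A B)) T.≈.refl)
      (T.≈.trans (T.≈.sym (F₁⟦⟧-∘ X (A ×̂ B) A C.π₁ C.⟨ f , g ⟩))
        (T.subst₂-≈ (F₀-⟦⟧ X) (F₀-⟦⟧ A) (F-resp C.project₁))) ,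
    T.≈.trans (D.∘-resp-≈ (T.≈.sym (F₁⟦⟧-π₂ A B)) T.≈.refl)
      (T.≈.trans (T.≈.sym (F₁⟦⟧-∘ X (A ×̂ B) B C.π₂ C.⟨ f , g ⟩))
        (T.subst₂-≈ (F₀-⟦⟧ X) (F₀-⟦⟧ B) (F-resp C.project₂)))

  mapTm-sound : ∀ {A B} (t : LP.Tm A B) → LR.⟦ mapTm t ⟧ₜ D.≈ F₁⟦⟧ A B LP.⟦ t ⟧ₜ
  mapTm-sound {A} LP.idₜ =
    T.≈.sym (T.≈.trans (T.subst₂-≈ (F₀-⟦⟧ A) (F₀-⟦⟧ A) F-id) (T.≈.reflexive (T.subst₂-id (F₀-⟦⟧ A))))
  mapTm-sound {A} {C'} (LP._∘ₜ_ {B = B} f g) =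
    T.≈.trans (D.∘-resp-≈ (mapTm-sound f) (mapTm-sound g)) (T.≈.sym (F₁⟦⟧-∘ A B C' LP.⟦ f ⟧ₜ LP.⟦ g ⟧ₜ))
  mapTm-sound (LP.p₁ {A} {B}) = T.≈.sym (F₁⟦⟧-π₁ A B)
  mapTm-sound (LP.p₂ {A} {B}) = T.≈.sym (F₁⟦⟧-π₂ A B)
  mapTm-sound {X} (LP.⟨_,_⟩ₜ {A = A} {B = B} f g) with F₁⟦⟧-pair X A B LP.⟦ f ⟧ₜ LP.⟦ g ⟧ₜ
  ... | π₁-pair , π₂-pair = D.unique (T.≈.trans π₁-pair (T.≈.sym (mapTm-sound f)))
                                     (T.≈.trans π₂-pair (T.≈.sym (mapTm-sound g)))
  mapTm-sound LP.!ₜ = D.!-unique _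
  mapTm-sound (LP.atom f) = T.≈.refl

  b⟦⟧ : ∀ A → P.Pred LP.⟦ A ⟧ → R.Pred LR.⟦ mapTy A ⟧
  b⟦⟧ A x = subst R.Pred (F₀-⟦⟧ A) (b LP.⟦ A ⟧ x)

  b⟦⟧-reindex : ∀ {Γ Δ} (t : LP.Tm Γ Δ) (α : P.Pred LP.⟦ Δ ⟧) →
                b⟦⟧ Γ (P.reindex LP.⟦ t ⟧ₜ α) R.≈ₚ R.reindex LR.⟦ mapTm t ⟧ₜ (b⟦⟧ Δ α)
  b⟦⟧-reindex {Γ} {Δ} t α = LR.L.Eq.trans (T.subst-≈ₚ (F₀-⟦⟧ Γ) (b-nat LP.⟦ t ⟧ₜ α))
    (LR.L.Eq.trans (LR.L.Eq.reflexive (T.subst-reindex (F₀-⟦⟧ Γ) (F₀-⟦⟧ Δ) (F₁ LP.⟦ t ⟧ₜ) (b _ α)))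
      (R.reindex-resp _ (T.≈.sym (mapTm-sound t))))

  b⟦⟧-∧ : ∀ Γ (x y : P.Pred LP.⟦ Γ ⟧) → b⟦⟧ Γ (x P.∧ₚ y) R.≈ₚ b⟦⟧ Γ x R.∧ₚ b⟦⟧ Γ y
  b⟦⟧-∧ Γ x y = LR.L.Eq.trans (T.subst-≈ₚ (F₀-⟦⟧ Γ) (b-∧ _ x y)) (LR.L.Eq.reflexive (T.subst-∧ (F₀-⟦⟧ Γ) _ _))

  b⟦⟧-⊤ : ∀ Γ → b⟦⟧ Γ P.⊤ₚ R.≈ₚ R.⊤ₚ
  b⟦⟧-⊤ Γ = LR.L.Eq.trans (T.subst-≈ₚ (F₀-⟦⟧ Γ) (b-⊤ _)) (LR.L.Eq.reflexive (T.subst-⊤ (F₀-⟦⟧ Γ)))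

  b⟦⟧-∃ : ∀ X Γ (α : P.Pred LP.⟦ X ×̂ Γ ⟧) → b⟦⟧ Γ (P.∃π α) R.≈ₚ R.∃π (b⟦⟧ (X ×̂ Γ) α)
  b⟦⟧-∃ X Γ α = LR.L.Eq.trans (T.subst-≈ₚ (F₀-⟦⟧ Γ) (b-∃ α))
    (LR.L.Eq.reflexive (trans (T.subst-∃π (F₀-⟦⟧ X) (F₀-⟦⟧ Γ) _)
      (cong R.∃π (T.subst-subst′ (F-× LP.⟦ X ⟧ LP.⟦ Γ ⟧) (cong₂ D._×₀_ (F₀-⟦⟧ X) (F₀-⟦⟧ Γ)) _))))

  b⟦⟧-δ : ∀ A → b⟦⟧ (A ×̂ A) (P.δ LP.⟦ A ⟧) R.≈ₚ R.δ LR.⟦ mapTy A ⟧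
  b⟦⟧-δ A = LR.L.Eq.trans
    (LR.L.Eq.reflexive (sym (T.subst-subst′ (F-× LP.⟦ A ⟧ LP.⟦ A ⟧) (cong₂ D._×₀_ (F₀-⟦⟧ A) (F₀-⟦⟧ A)) _)))
    (LR.L.Eq.trans (T.subst-≈ₚ (cong₂ D._×₀_ (F₀-⟦⟧ A) (F₀-⟦⟧ A)) (b-δ LP.⟦ A ⟧))
                   (LR.L.Eq.reflexive (T.subst-δ (F₀-⟦⟧ A))))

  b⟦⟧-mono : ∀ Γ {x y : P.Pred LP.⟦ Γ ⟧} → x P.≤ₚ y → b⟦⟧ Γ x R.≤ₚ b⟦⟧ Γ y
  b⟦⟧-mono Γ {x} {y} x≤y = T.subst-≤ₚ (F₀-⟦⟧ Γ)
    (LR.≤-trans (LR.≈⇒≤ (b-cong _ (LP.antisym (LP.∧-intro LP.≤-refl x≤y) LP.∧-fst)))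
      (LR.≤-trans (LR.≈⇒≤ (b-∧ _ x y)) LR.∧-snd))

  mapFm : ∀ {Γ} → LP.Fm Γ → LR.Fm (mapTy Γ)
  mapFm (LP.lift {Γ} α) = LR.lift (b⟦⟧ Γ α)
  mapFm (φ LP.∧f ψ) = mapFm φ LR.∧f mapFm ψ
  mapFm LP.⊤f = LR.⊤f
  mapFm (LP.∃f φ) = LR.∃f (mapFm φ)
  mapFm (φ LP.[ t ]f) = mapFm φ LR.[ mapTm t ]f

  mapFm-sound : ∀ {Γ} (φ : LP.Fm Γ) → b⟦⟧ Γ LP.⟦ φ ⟧F R.≈ₚ LR.⟦ mapFm φ ⟧F
  mapFm-sound (LP.lift α) = LR.L.Eq.refl
  mapFm-sound {Γ} (φ LP.∧f ψ) = LR.L.Eq.trans (b⟦⟧-∧ Γ _ _) (LR.MS.∧-cong (mapFm-sound φ) (mapFm-sound ψ))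
  mapFm-sound {Γ} LP.⊤f = b⟦⟧-⊤ Γ
  mapFm-sound {Γ} (LP.∃f {X} φ) = LR.L.Eq.trans (b⟦⟧-∃ X Γ _) (LR.∃-cong (mapFm-sound φ))
  mapFm-sound (φ LP.[ t ]f) = LR.L.Eq.trans (b⟦⟧-reindex t _) (R.reindex-cong _ (mapFm-sound φ))

  b⟦⟧-graph : ∀ {X Y} (t : LP.Tm X Y) → b⟦⟧ (X ×̂ Y) LP.⟦ LP.ΓF t ⟧F R.≈ₚ LR.⟦ LR.ΓF (mapTm t) ⟧F
  b⟦⟧-graph {X} {Y} t = LR.L.Eq.trans (mapFm-sound (LP.ΓF t)) (R.reindex-cong _ (b⟦⟧-δ Y))

  𝓛₁≈ : ∀ A B {p : F₀ LP.⟦ A ⟧ ≡ LR.⟦ mapTy A ⟧} {q : F₀ LP.⟦ B ⟧ ≡ LR.⟦ mapTy B ⟧} →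
        p ≡ F₀-⟦⟧ A → q ≡ F₀-⟦⟧ B → {x : P.Pred LP.⟦ A ×̂ B ⟧} {y : R.Pred LR.⟦ mapTy (A ×̂ B) ⟧} →
        b⟦⟧ (A ×̂ B) x R.≈ₚ y →
        subst₂ (λ X Y → R.Pred (X D.×₀ Y)) p q (subst R.Pred (F-× LP.⟦ A ⟧ LP.⟦ B ⟧) (b _ x)) R.≈ₚ y
  𝓛₁≈ A B refl refl {x} = LR.L.Eq.trans
    (LR.L.Eq.reflexive (T.subst₂-relation (F₀-⟦⟧ A) (F₀-⟦⟧ B) (F-× LP.⟦ A ⟧ LP.⟦ B ⟧) (b _ x)))

  isCBCMorphism : IsCBCMorphism LP.isCartesianBicategory LR.isCartesianBicategory (𝓛 m)
  isCBCMorphism = record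
    { F-mono = λ {X} {Y} → b⟦⟧-mono (` X ×̂ ` Y)
    ; F-id = λ {X} → b-δ X
    ; F-⨾ = λ {X} {Y} {Z} f g → mapFm-sound (LP.compF {` X} {` Y} {` Z} (LP.lift f) (LP.lift g))
    ; F-⊗₀ = F-×
    ; F-𝕀 = F-𝟙
    ; F-⊗₁ = λ {X} {Y} {Z} {W} f g → 𝓛₁≈ (` X ×̂ ` Z) (` Y ×̂ ` W) refl refl
        (mapFm-sound (LP.tensF {` X} {` Y} {` Z} {` W} (LP.lift f) (LP.lift g)))
    ; F-α = λ {X} {Y} {Z} → 𝓛₁≈ ((` X ×̂ ` Y) ×̂ ` Z) (` X ×̂ (` Y ×̂ ` Z))
        (T.trans-cong-×ˡ (F-× (X C.×₀ Y) Z) (F-× X Y)) (T.trans-cong-×ʳ (F-× X (Y C.×₀ Z)) (F-× Y Z))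
        (b⟦⟧-graph (LP.αₜ (` X) (` Y) (` Z)))
    ; F-α⁻¹ = λ {X} {Y} {Z} → 𝓛₁≈ (` X ×̂ (` Y ×̂ ` Z)) ((` X ×̂ ` Y) ×̂ ` Z)
        (T.trans-cong-×ʳ (F-× X (Y C.×₀ Z)) (F-× Y Z)) (T.trans-cong-×ˡ (F-× (X C.×₀ Y) Z) (F-× X Y))
        (b⟦⟧-graph (LP.α⁻¹ₜ (` X) (` Y) (` Z)))
    ; F-lu = λ {X} → 𝓛₁≈ (𝟙̂ ×̂ ` X) (` X) (T.trans-cong-×ˡ (F-× C.𝟙 X) F-𝟙) refl
        (b⟦⟧-graph (LP.luₜ (` X)))
    ; F-lu⁻¹ = λ {X} → 𝓛₁≈ (` X) (𝟙̂ ×̂ ` X) refl (T.trans-cong-×ˡ (F-× C.𝟙 X) F-𝟙)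
        (b⟦⟧-graph (LP.lu⁻¹ₜ (` X)))
    ; F-ru = λ {X} → 𝓛₁≈ (` X ×̂ 𝟙̂) (` X) (T.trans-cong-×ʳ (F-× X C.𝟙) F-𝟙) refl
        (b⟦⟧-graph (LP.ruₜ (` X)))
    ; F-ru⁻¹ = λ {X} → 𝓛₁≈ (` X) (` X ×̂ 𝟙̂) refl (T.trans-cong-×ʳ (F-× X C.𝟙) F-𝟙)
        (b⟦⟧-graph (LP.ru⁻¹ₜ (` X)))
    ; F-d = λ {X} → 𝓛₁≈ (` X) (` X ×̂ ` X) refl refl (b⟦⟧-graph (LP.Δₜ {` X}))
    ; F-e = λ {X} → 𝓛₁≈ (` X) 𝟙̂ refl refl (b⟦⟧-graph (LP.!ₜ {` X}))
    ; F-d* = λ {X} → 𝓛₁≈ (` X ×̂ ` X) (` X) refl refl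
        (LR.L.Eq.trans (mapFm-sound (LP.d*F (` X))) (R.reindex-cong _ (b⟦⟧-δ (` X ×̂ ` X))))
    ; F-e* = λ {X} → 𝓛₁≈ 𝟙̂ (` X) refl refl (b⟦⟧-⊤ (𝟙̂ ×̂ ` X))
    }

module _ {o h e c ℓ₁ ℓ₂ : Level} where
  private
    module 𝒜 (𝐏 : EEDObj o h e c ℓ₁ ℓ₂) = CBData (𝒜 𝐏)
    Pred : (𝐏 : EEDObj o h e c ℓ₁ ℓ₂) → CartesianCategory.Obj (EEDObj.Base 𝐏) → Set c
    Pred 𝐏 = EED.Pred (EEDObj.Doc 𝐏)

  𝓛-identity : (𝐏 : EEDObj o h e c ℓ₁ ℓ₂) {X Y : 𝒜.Obj 𝐏} (r : 𝒜.Hom 𝐏 X Y) →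
               𝒜._≈_ 𝐏 (CBFunctor.F₁ (𝓛 (idEED 𝐏)) r) r
  𝓛-identity 𝐏 r = BoundedMeetSemilattice.Eq.refl (EED.Fib (EEDObj.Doc 𝐏) _)

  subst-b : {𝐑 𝐒 : EEDObj o h e c ℓ₁ ℓ₂} (n : EEDHom 𝐑 𝐒) {U U' : CartesianCategory.Obj (EEDObj.Base 𝐑)}
            (p : U ≡ U') {W : CartesianCategory.Obj (EEDObj.Base 𝐒)}
            (q : StrictCartesianFunctor.F₀ (EEDHom.F n) U' ≡ W) (x : Pred 𝐑 U) →
            subst (Pred 𝐒) (trans (cong (StrictCartesianFunctor.F₀ (EEDHom.F n)) p) q) (EEDHom.b n U x)
            ≡ subst (Pred 𝐒) q (EEDHom.b n U' (subst (Pred 𝐑) p x))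
  subst-b n refl q x = refl

  𝓛-homomorphism : (𝐏 𝐑 𝐒 : EEDObj o h e c ℓ₁ ℓ₂) (m : EEDHom 𝐏 𝐑) (n : EEDHom 𝐑 𝐒)
                   {X Y : 𝒜.Obj 𝐏} (r : 𝒜.Hom 𝐏 X Y) →
                   𝒜._≈_ 𝐒 (CBFunctor.F₁ (𝓛 (n ∘E m)) r) (CBFunctor.F₁ (𝓛 n) (CBFunctor.F₁ (𝓛 m) r))
  𝓛-homomorphism 𝐏 𝐑 𝐒 m n {X} {Y} r = BoundedMeetSemilattice.Eq.reflexive (EED.Fib (EEDObj.Doc 𝐒) _)
    (subst-b n (StrictCartesianFunctor.F-× (EEDHom.F m) X Y) (StrictCartesianFunctor.F-× (EEDHom.F n) _ _) _)

theorem6p3 : ∀ {o h e c ℓ₁ ℓ₂ : Level} →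
    Σ ((𝐏 : EEDObj o h e c ℓ₁ ℓ₂) → IsCartesianBicategory (𝒜 𝐏)) (λ cb →
      ((𝐏 𝐑 : EEDObj o h e c ℓ₁ ℓ₂) (m : EEDHom 𝐏 𝐑) →
         IsCBCMorphism (cb 𝐏) (cb 𝐑) (𝓛 m))
      × ((𝐏 : EEDObj o h e c ℓ₁ ℓ₂) {X Y : CBData.Obj (𝒜 𝐏)}
         (r : CBData.Hom (𝒜 𝐏) X Y) →
         CBData._≈_ (𝒜 𝐏) (CBFunctor.F₁ (𝓛 (idEED 𝐏)) r) r)
      × ((𝐏 𝐑 𝐒 : EEDObj o h e c ℓ₁ ℓ₂) (m : EEDHom 𝐏 𝐑) (n : EEDHom 𝐑 𝐒)
         {X Y : CBData.Obj (𝒜 𝐏)} (r : CBData.Hom (𝒜 𝐏) X Y) →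
         CBData._≈_ (𝒜 𝐒) (CBFunctor.F₁ (𝓛 (n ∘E m)) r)
                          (CBFunctor.F₁ (𝓛 n) (CBFunctor.F₁ (𝓛 m) r))))
theorem6p3 =
  (λ 𝐏 → RelationsOf.isCartesianBicategory 𝐏) ,
  (λ 𝐏 𝐑 m → Preservation.isCBCMorphism m) ,
  𝓛-identity ,
  𝓛-homomorphism
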